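{- For every SO-HORN (resp. SO-HORN$^*$, SO-HORN$^r$, SO-HORN$^{*r}$) formula $\phi(\bar x)$ over a vocabulary $\sigma$ there is a DATALOG (resp. DATALOG$^*$, DATALOG$^r$, DATALOG$^{*r}$) formula $(\Pi,P)\bar t$ over a vocabulary $\tau$ with $\sigma=(\tau,\Pi)_{ext}$ such that: if $\phi$ is a sentence, then $P$ is a zero-ary intentional symbol and for every finite $\sigma$-structure $\mathcal A$, $\mathcal A\models\phi$ iff $P^{\mathcal A[\Pi]}$ is FALSE; if $\phi(\bar x)$ has free variables $\bar x=x_1,\dots,x_r$, then $P$ is an $r$-ary intentional symbol and for every finite $\sigma$-structure $\mathcal A$ and all $\bar a=a_1,\dots,a_r\in A$, $\mathcal A\models\phi[\bar a]$ iff $(a_1,\dots,a_r)\notin P^{\mathcal A[\Pi]}$. Conversely, for every DATALOG (resp. DATALOG$^*$, DATALOG$^r$, DATALOG$^{*r}$) formula $(\Pi,P)\bar t$ there is a SO-HORN (resp. SO-HORN$^*$, SO-HORN$^r$, SO-HORN$^{*r}$) formula $\phi$ over $(\tau,\Pi)_{ext}$ standing in the same relationship to $(\Pi,P)\bar t$.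
   Context: All structures are finite; vocabularies are finite sets of relation and constant symbols. SO-HORN$(\sigma)$ is the set of second-order formulas $Q_1R_1\cdots Q_mR_m\forall\bar x\,(C_1\wedge\cdots\wedge C_n)$, $Q_i\in\{\forall,\exists\}$, $R_1,\dots,R_m$ relation variables not in $\sigma$, each $C_j$ an implication $\alpha_1\wedge\cdots\wedge\alpha_l\wedge\beta_1\wedge\cdots\wedge\beta_q\to H$ with: (1) each $\alpha_s$ atomic $R_i\bar x$; (2) each $\beta_t$ atomic or negated atomic $P\bar y$ with $P\notin\{R_1,\dots,R_m\}$; (3) $H$ atomic $R_k\bar z$ or $\bot$. SO-HORN$^*$: replace (2) by (2') each $\beta_t$ is a first-order formula not containing $R_1,\dots,R_m$. SO-HORN$^r$: replace (1) by (1') each $\alpha_s$ is atomic $R_i\bar x$ or of the form $\forall\bar yR_i\bar y\bar z$. SO-HORN$^{*r}$: both (1') and (2'). A DATALOG program $\Pi$ over $\tau$ is a finite set of rules $\beta\leftarrow\alpha_1,\dots,\alpha_l$ ($l\ge0$), each $\alpha_i$ an atomic formula, negated atomic formula or zero-ary relation symbol, the head $\beta$ an atomic formula $R\bar x$ or a zero-ary relation symbol. Relation symbols occurring in heads are intentional; all other symbols (including constants) are extensional, forming $(\tau,\Pi)_{ext}$; intentional symbols occur only positively; by convention zero-ary relation symbols occur only in heads. DATALOG$^*$ additionally allows in bodies first-order formulas over extensional symbols only; DATALOG$^r$ additionally allows formulas $\forall\bar yR\bar y\bar z$ with $R$ intentional; DATALOG$^{*r}$ allows both. Semantics: for a finite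 $(\tau,\Pi)_{ext}$-structure $\mathcal A$, intentional relations start empty (zero-ary: FALSE), and stage $i+1$ of $R$ is the set of tuples $\bar a$ such that for some rule with head $R\bar x$ and some assignment mapping $\bar x$ to $\bar a$ all body formulas hold in $\mathcal A$ expanded by the stage-$i$ relations (a zero-ary head becomes TRUE when some rule for it has a satisfied body); stages increase to a fixed point, and $\mathcal A[\Pi]$ is $\mathcal A$ expanded by the fixed points. A formula $(\Pi,P)\bar t$ consists of an intentional $P$ (of arity $r$) and new variables $\bar t=t_1,\dots,t_r$. -}

module Defs where

open import Data.Bool using (Bool; true; false; T)
open import Data.Nat using (ℕ; zero; suc; _+_; NonZero)
open import Data.Fin using (Fin)
open import Data.Vec using (Vec; []; _∷_; lookup; map; _++_)
open import Data.List using (List)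
open import Data.List.Relation.Unary.All using (All)
open import Data.List.Relation.Unary.Any using (Any)
open import Data.List.Membership.Propositional using (_∈_)
open import Data.Maybe using (Maybe; just; nothing)
open import Data.Product using (Σ; _×_; _,_)
open import Data.Sum using (_⊎_)
open import Data.Empty using (⊥)
open import Data.Unit using (⊤)
open import Relation.Binary.PropositionalEquality using (_≡_; subst; sym)
open import Relation.Nullary using (¬_)
open import Function.Bundles using (_⇔_)

record Vocab : Set where
  field
    nrel  : ℕ
    arity : Fin nrel → ℕ
    ncon  : ℕ
open Vocab public

record Structure (σ : Vocab) (A : Set) : Set where
  field
    rel : (R : Fin (nrel σ)) → Vec A (arity σ R) → Bool
    con : Fin (ncon σ) → A
open Structure public

Rel : Set → ℕ → Set
Rel A k = Vec A k → Bool

data Term (σ : Vocab) (n : ℕ) : Set where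
  var : Fin n → Term σ n
  cst : Fin (ncon σ) → Term σ n

evalT : {σ : Vocab} {A : Set} {n : ℕ} → Structure σ A → Vec A n → Term σ n → A
evalT 𝒜 env (var x) = lookup env x
evalT 𝒜 env (cst c) = con 𝒜 c

data Atom (σ : Vocab) (n : ℕ) : Set where
  relA : (R : Fin (nrel σ)) → Vec (Term σ n) (arity σ R) → Atom σ n
  eqA  : Term σ n → Term σ n → Atom σ n

AtomSem : {σ : Vocab} {A : Set} {n : ℕ} → Structure σ A → Vec A n → Atom σ n → Set
AtomSem 𝒜 env (relA R ts) = rel 𝒜 R (map (evalT 𝒜 env) ts) ≡ true
AtomSem 𝒜 env (eqA s t)   = evalT 𝒜 env s ≡ evalT 𝒜 env t

data Literal (σ : Vocab) (n : ℕ) : Set where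
  pos : Atom σ n → Literal σ n
  neg : Atom σ n → Literal σ n

LitSem : {σ : Vocab} {A : Set} {n : ℕ} → Structure σ A → Vec A n → Literal σ n → Set
LitSem 𝒜 env (pos a) = AtomSem 𝒜 env a
LitSem 𝒜 env (neg a) = ¬ AtomSem 𝒜 env a

data Formula (σ : Vocab) : ℕ → Set where
  atom : {n : ℕ} → Atom σ n → Formula σ n
  ⊤f ⊥f : {n : ℕ} → Formula σ n
  ¬f : {n : ℕ} → Formula σ n → Formula σ n
  _∧f_ _∨f_ _⇒f_ : {n : ℕ} → Formula σ n → Formula σ n → Formula σ n
  ∀f ∃f : {n : ℕ} → Formula σ (suc n) → Formula σ n

FormSem : {σ : Vocab} {A : Set} {n : ℕ} → Structure σ A → Vec A n → Formula σ n → Set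
FormSem 𝒜 env (atom a)  = AtomSem 𝒜 env a
FormSem 𝒜 env ⊤f        = ⊤
FormSem 𝒜 env ⊥f        = ⊥
FormSem 𝒜 env (¬f φ)    = ¬ FormSem 𝒜 env φ
FormSem 𝒜 env (φ ∧f ψ)  = FormSem 𝒜 env φ × FormSem 𝒜 env ψ
FormSem 𝒜 env (φ ∨f ψ)  = FormSem 𝒜 env φ ⊎ FormSem 𝒜 env ψ
FormSem 𝒜 env (φ ⇒f ψ)  = FormSem 𝒜 env φ → FormSem 𝒜 env ψ
FormSem {A = A} 𝒜 env (∀f φ) = (a : A) → FormSem 𝒜 (a ∷ env) φ
FormSem {A = A} 𝒜 env (∃f φ) = Σ A λ a → FormSem 𝒜 (a ∷ env) φ

-- The flag s ("star") allows first-order formulas over the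
-- extensional/given vocabulary (SO-HORN^*, DATALOG^*); the flag u
-- allows formulas ∀ȳ R ȳ z̄ (SO-HORN^r, DATALOG^r).
-- (s,u) = (false,false): plain; (true,false): *; (false,true): r;
-- (true,true): *r.

data Quant : Set where
  ∀q ∃q : Quant

QSem : Quant → {B : Set} → (B → Set) → Set
QSem ∀q {B} P = (b : B) → P b
QSem ∃q {B} P = Σ B P

PrefixSem : (A : Set) (m : ℕ) (q : Fin m → Quant) (ar : Fin m → ℕ) →
            (((i : Fin m) → Rel A (ar i)) → Set) → Set
PrefixSem A zero q ar body = body (λ ())
PrefixSem A (suc m) q ar body =
  QSem (q Fin.zero) λ (R₀ : Rel A (ar Fin.zero)) →
    PrefixSem A m (λ i → q (Fin.suc i)) (λ i → ar (Fin.suc i))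
      (λ Rs → body (λ { Fin.zero → R₀ ; (Fin.suc i) → Rs i }))
  where import Data.Fin as Fin

module _ (s u : Bool) (σ : Vocab) (m : ℕ) (ar : Fin m → ℕ) (n : ℕ) where

  -- body atoms α: R_i t̄, or (if u) ∀ȳ R_i ȳ z̄ with |ȳ| = j, |z̄| = l
  data SOAtom : Set where
    ratom : (i : Fin m) → Vec (Term σ n) (ar i) → SOAtom
    uatom : T u → (i : Fin m) (j l : ℕ) → ar i ≡ j + l → Vec (Term σ n) l → SOAtom

  data Beta : Set where
    lit : Literal σ n → Beta
    fo  : T s → Formula σ n → Beta

  -- α₁ ∧ ⋯ ∧ α_l ∧ β₁ ∧ ⋯ ∧ β_q → H, with H = R_k z̄ (just) or ⊥ (nothing)
  record Clause : Set where
    field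
      alphas : List SOAtom
      betas  : List Beta
      head   : Maybe (Σ (Fin m) λ i → Vec (Term σ n) (ar i))

-- An SO-HORN formula over σ whose free first-order variables are
-- x₁,…,x_r:  Q₁R₁ ⋯ Q_mR_m ∀y₁…y_k (C₁ ∧ ⋯ ∧ C_c).
-- In the matrix, variables 0..r-1 are x̄ and r..r+k-1 are ȳ.
record SOHorn (s u : Bool) (σ : Vocab) (r : ℕ) : Set where
  field
    m       : ℕ
    q       : Fin m → Quant
    ar      : Fin m → ℕ
    k       : ℕ
    clauses : List (Clause s u σ m ar (r + k))

module _ {s u : Bool} {σ : Vocab} {A : Set} {m : ℕ} {ar : Fin m → ℕ} {n : ℕ}
         (𝒜 : Structure σ A) (Rs : (i : Fin m) → Rel A (ar i)) (env : Vec A n) where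

  SOAtomSem : SOAtom s u σ m ar n → Set
  SOAtomSem (ratom i ts) = Rs i (map (evalT 𝒜 env) ts) ≡ true
  SOAtomSem (uatom _ i j l e z) =
    (b : Vec A j) → Rs i (subst (Vec A) (sym e) (b ++ map (evalT 𝒜 env) z)) ≡ true

  BetaSem : Beta s u σ m ar n → Set
  BetaSem (lit L)  = LitSem 𝒜 env L
  BetaSem (fo _ φ) = FormSem 𝒜 env φ

  HeadSem : Maybe (Σ (Fin m) λ i → Vec (Term σ n) (ar i)) → Set
  HeadSem nothing         = ⊥
  HeadSem (just (i , ts)) = Rs i (map (evalT 𝒜 env) ts) ≡ true

  ClauseSem : Clause s u σ m ar n → Set
  ClauseSem C = All SOAtomSem (Clause.alphas C) → All BetaSem (Clause.betas C) →
                HeadSem (Clause.head C)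

Sat : {s u : Bool} {σ : Vocab} {A : Set} {r : ℕ} →
      Structure σ A → SOHorn s u σ r → Vec A r → Set
Sat {A = A} 𝒜 φ ā =
  PrefixSem A (SOHorn.m φ) (SOHorn.q φ) (SOHorn.ar φ) λ Rs →
    (b : Vec A (SOHorn.k φ)) → All (ClauseSem 𝒜 Rs (ā ++ b)) (SOHorn.clauses φ)

-- DATALOG
-- A program has extensional vocabulary σ and I intentional symbols with
-- arities iar; τ is σ together with the intentional symbols.

module _ (s u : Bool) (σ : Vocab) (I : ℕ) (iar : Fin I → ℕ) where

  -- Intentional symbols
  -- occur only positively; by convention zero-ary (intentional) symbols
  -- occur only in heads, hence the NonZero side condition.
  data Body (n : ℕ) : Set where
    iatom : (p : Fin I) → NonZero (iar p) → Vec (Term σ n) (iar p) → Body n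
    elit  : Literal σ n → Body n
    efo   : T s → Formula σ n → Body n
    iuniv : T u → (p : Fin I) → NonZero (iar p) → (j l : ℕ) →
            iar p ≡ j + l → Vec (Term σ n) l → Body n

  record Rule : Set where
    field
      nv    : ℕ
      hd    : Fin I
      hargs : Vec (Term σ nv) (iar hd)
      body  : List (Body nv)

record Program (s u : Bool) (σ : Vocab) : Set where
  field
    I     : ℕ
    iar   : Fin I → ℕ
    rules : List (Rule s u σ I iar)
    heads : (p : Fin I) → Any (λ ρ → Rule.hd ρ ≡ p) rules

module _ {s u : Bool} {σ : Vocab} {I : ℕ} {iar : Fin I → ℕ} {A : Set}
         (𝒜 : Structure σ A) where

  BodySem : {n : ℕ} → ((p : Fin I) → Vec A (iar p) → Set) → Vec A n →
            Body s u σ I iar n → Set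
  BodySem J env (iatom p _ ts) = J p (map (evalT 𝒜 env) ts)
  BodySem J env (elit L)       = LitSem 𝒜 env L
  BodySem J env (efo _ φ)      = FormSem 𝒜 env φ
  BodySem J env (iuniv _ p _ j l e z) =
    (b : Vec A j) → J p (subst (Vec A) (sym e) (b ++ map (evalT 𝒜 env) z))

  data Derives (rules : List (Rule s u σ I iar))
               (J : (p : Fin I) → Vec A (iar p) → Set) :
               (p : Fin I) → Vec A (iar p) → Set where
    fire : (ρ : Rule s u σ I iar) → ρ ∈ rules → (env : Vec A (Rule.nv ρ)) →
           All (BodySem J env) (Rule.body ρ) →
           Derives rules J (Rule.hd ρ) (map (evalT 𝒜 env) (Rule.hargs ρ))

  Stage : (rules : List (Rule s u σ I iar)) → ℕ → (p : Fin I) → Vec A (iar p) → Set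
  Stage rules zero    p a = ⊥
  Stage rules (suc i) p a = Derives rules (Stage rules i) p a

FixRel : {s u : Bool} {σ : Vocab} {A : Set} → Structure σ A → (Π : Program s u σ) →
         (p : Fin (Program.I Π)) → Vec A (Program.iar Π p) → Set
FixRel 𝒜 Π p a = Σ ℕ λ i → Stage 𝒜 (Program.rules Π) i p a

record DatalogFormula (s u : Bool) (σ : Vocab) (r : ℕ) : Set where
  field
    prog   : Program s u σ
    P      : Fin (Program.I prog)
    arityP : Program.iar prog P ≡ r

-- ā ∈ P^{𝒜[Π]}   (for r = 0: P^{𝒜[Π]} is TRUE)
InFix : {s u : Bool} {σ : Vocab} {A : Set} {r : ℕ} →
        Structure σ A → DatalogFormula s u σ r → Vec A r → Set
InFix {A = A} 𝒜 D ā =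
  FixRel 𝒜 (DatalogFormula.prog D) (DatalogFormula.P D)
    (subst (Vec A) (sym (DatalogFormula.arityP D)) ā)

Corresponds : {s u : Bool} {σ : Vocab} {r : ℕ} →
              SOHorn s u σ r → DatalogFormula s u σ r → Set
Corresponds {σ = σ} {r = r} φ D =
  (N : ℕ) (𝒜 : Structure σ (Fin (suc N))) (ā : Vec (Fin (suc N)) r) →
  Sat 𝒜 φ ā ⇔ (¬ InFix 𝒜 D ā)

-- A DATALOG formula (Π, P) t̄ is read as the SO-HORN formula ∃R̄ ∀ȳ (rules of Π ∧ ¬ P t̄): the least fixed
-- point of Π is the least interpretation closed under its rules, so ā is not in P exactly when some
-- interpretation closed under the rules avoids P ā.
--
-- Conversely, the relation quantifiers of an SO-HORN formula are removed from the innermost outwards, keeping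
-- the formula of the shape ∃S̄ ∀ȳ ψ with ψ Horn.  An existential quantifier just joins the block S̄.  A
-- universal one is eliminated because the interpretations satisfying a Horn formula are closed under
-- intersections, and every relation R is the intersection of the full relation with the relations
-- "all tuples but z̄", z̄ ∉ R: thus ∀R ∃S̄ ψ holds iff ψ(full, S̄¹) and ψ(all but z̄, S̄²(·, z̄)) for every z̄,
-- which is again existential Horn in S̄¹, S̄².  Finally ∃S̄ ∀ȳ ψ(x̄) becomes the program whose rules are the
-- clauses of ψ, with the values of x̄ as extra arguments of the S̄ and the clauses with head ⊥ deriving P x̄.

module Submission where

open import Defs
open import Data.Bool using (Bool; true; false; T; if_then_else_)
open import Data.Bool.Properties using () renaming (_≟_ to _≟ᵇ_)
open import Data.Empty using (⊥; ⊥-elim)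
open import Data.Fin as Fin using (Fin; zero; suc)
open import Data.Fin.Properties using (splitAt-↑ˡ; splitAt-↑ʳ)
open import Data.List as L using (List; []; _∷_; length)
open import Data.List.Membership.Propositional using (_∈_; find; lose; mapWith∈)
open import Data.List.Membership.Propositional.Properties
  using (∈-map⁺; ∈-map⁻; ∈-cartesianProduct⁺; ∈-allFin; ∈-concatMap⁺; ∈-++⁻; ∈-++⁺ˡ)
open import Data.List.Relation.Unary.All as All using (All)
import Data.List.Relation.Unary.All.Properties as AllP
open import Data.List.Relation.Unary.Any as Any using (Any; here; there)
import Data.List.Relation.Unary.Any.Properties as AnyP
open import Data.Maybe using (Maybe; just; nothing)
open import Data.Nat using (ℕ; zero; suc; _+_; _∸_; _≤_; _<_; z≤n; s≤s; NonZero)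
open import Data.Nat.Properties using (≤-trans; <-irrefl; m≤n⇒m≤1+n; ≤-total; n≤1+n; m∸n+n≡m; +-assoc; ≤-totalOrder)
open import Data.List.Extrema ≤-totalOrder using (max; xs≤max)
open import Data.Product using (Σ; _×_; _,_; proj₁; proj₂; uncurry)
import Data.Product.Properties as ΣP
open import Data.Sum as Sum using (_⊎_; inj₁; inj₂; [_,_]′)
open import Data.Unit using (⊤; tt)
open import Data.Vec as V using (Vec; []; _∷_; lookup; map; _++_)
import Data.Vec.Properties as VP
open import Function using (_∘_)
open import Function.Bundles using (_⇔_; mk⇔; Equivalence)
import Function.Properties.Equivalence as ⇔
import Level
open import Relation.Binary using (DecidableEquality)
open import Relation.Binary.PropositionalEquality
import Relation.Binary.Reasoning.Setoid
open import Relation.Nullary using (Dec; yes; no; does; ¬_; ¬?; _×-dec_; _⊎-dec_; _→-dec_; contradiction)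
open import Relation.Nullary.Decidable using (map′; dec-true; decidable-stable)

open Equivalence using (to; from)

≡⇒⇔ : {P Q : Set} → P ≡ Q → P ⇔ Q
≡⇒⇔ refl = ⇔.refl

module ⇔-Reasoning = Relation.Binary.Reasoning.Setoid (⇔.⇔-setoid Level.zero)

×-cong⇔ : {P P′ Q Q′ : Set} → P ⇔ P′ → Q ⇔ Q′ → (P × Q) ⇔ (P′ × Q′)
×-cong⇔ P⇔P′ Q⇔Q′ = mk⇔ (λ (p , q) → to P⇔P′ p , to Q⇔Q′ q) (λ (p , q) → from P⇔P′ p , from Q⇔Q′ q)

⊎-cong⇔ : {P P′ Q Q′ : Set} → P ⇔ P′ → Q ⇔ Q′ → (P ⊎ Q) ⇔ (P′ ⊎ Q′)
⊎-cong⇔ P⇔P′ Q⇔Q′ = mk⇔ (Sum.map (to P⇔P′) (to Q⇔Q′)) (Sum.map (from P⇔P′) (from Q⇔Q′))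

→-cong⇔ : {P P′ Q Q′ : Set} → P ⇔ P′ → Q ⇔ Q′ → (P → Q) ⇔ (P′ → Q′)
→-cong⇔ P⇔P′ Q⇔Q′ = mk⇔ (λ f → to Q⇔Q′ ∘ f ∘ from P⇔P′) (λ f → from Q⇔Q′ ∘ f ∘ to P⇔P′)

Σ-cong⇔ : {X : Set} {P Q : X → Set} → (∀ x → P x ⇔ Q x) → Σ X P ⇔ Σ X Q
Σ-cong⇔ P⇔Q = mk⇔ (λ (x , p) → x , to (P⇔Q x) p) (λ (x , q) → x , from (P⇔Q x) q)

Π-cong⇔ : {X : Set} {P Q : X → Set} → (∀ x → P x ⇔ Q x) → ((x : X) → P x) ⇔ ((x : X) → Q x)
Π-cong⇔ P⇔Q = mk⇔ (λ f x → to (P⇔Q x) (f x)) (λ f x → from (P⇔Q x) (f x))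

All-cong⇔ : {X : Set} {P Q : X → Set} → (∀ x → P x ⇔ Q x) → ∀ {xs} → All P xs ⇔ All Q xs
All-cong⇔ P⇔Q = mk⇔ (All.map (λ {x} → to (P⇔Q x))) (All.map (λ {x} → from (P⇔Q x)))

All-map⇔ : {X Y : Set} {P : Y → Set} {f : X → Y} {xs : List X} → All P (L.map f xs) ⇔ All (P ∘ f) xs
All-map⇔ = mk⇔ AllP.map⁻ AllP.map⁺

All-singleton⇔ : {X : Set} {P : X → Set} {x : X} → All P (x ∷ []) ⇔ P x
All-singleton⇔ = mk⇔ All.head (All._∷ All.[])

All-concatMap⇔ : {X Y : Set} {P : Y → Set} (f : X → List Y) {xs : List X} → All P (L.concatMap f xs) ⇔ All (All P ∘ f) xs
All-concatMap⇔ f = mk⇔ (AllP.map⁻ ∘ AllP.concat⁻) (AllP.concat⁺ ∘ AllP.map⁺)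

All-++⇔ : {X : Set} {P : X → Set} (xs : List X) {ys : List X} → All P (xs L.++ ys) ⇔ (All P xs × All P ys)
All-++⇔ xs = mk⇔ (AllP.++⁻ xs) (uncurry AllP.++⁺)

All-×⇔ : {X : Set} {P Q : X → Set} {xs : List X} → All (λ x → P x × Q x) xs ⇔ (All P xs × All Q xs)
All-×⇔ = mk⇔ All.unzip All.zip

⇔-All-left : {X Y P : Set} {Q : X → Set} {R : Y → Set} {x : X} → P ⇔ Q x → P ⇔ (All Q (x ∷ []) × All R [])
⇔-All-left P⇔Q = ⇔.trans P⇔Q (mk⇔ (λ q → (q All.∷ All.[]) , All.[]) (All.head ∘ proj₁))

⇔-All-right : {X Y P : Set} {Q : X → Set} {R : Y → Set} {y : Y} → P ⇔ R y → P ⇔ (All Q [] × All R (y ∷ []))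
⇔-All-right P⇔R = ⇔.trans P⇔R (mk⇔ (λ q → All.[] , (q All.∷ All.[])) (All.head ∘ proj₂))

Π-All⇔All-Π : {X B : Set} {P : B → X → Set} {xs : List X} → ((b : B) → All (P b) xs) ⇔ All (λ x → (b : B) → P b x) xs
Π-All⇔All-Π {xs = []}     = mk⇔ (λ _ → All.[]) (λ _ _ → All.[])
Π-All⇔All-Π {xs = x ∷ xs} = mk⇔ (λ f → (λ b → All.head (f b)) All.∷ to Π-All⇔All-Π (All.tail ∘ f))
                                 (λ { (p All.∷ ps) b → p b All.∷ from Π-All⇔All-Π ps b })

All-mapWith∈⇔ : {X Y : Set} {P : Y → Set} (xs : List X) {f : ∀ {x} → x ∈ xs → Y} →
                All P (mapWith∈ xs f) ⇔ (∀ {x} (x∈ : x ∈ xs) → P (f x∈))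
All-mapWith∈⇔ []       = mk⇔ (λ _ ()) (λ _ → All.[])
All-mapWith∈⇔ (x ∷ xs) = mk⇔
  (λ { (p All.∷ ps) (here refl) → p ; (p All.∷ ps) (there x∈) → to (All-mapWith∈⇔ xs) ps x∈ })
  (λ g → g (here refl) All.∷ from (All-mapWith∈⇔ xs) (λ x∈ → g (there x∈)))

choices : {X : Set} → List (List X) → List (List X)
choices []       = [] ∷ []
choices (d ∷ ds) = L.concatMap (λ x → L.map (x ∷_) (choices ds)) d

All-Any⇔Any-All-choices : {X : Set} {P : X → Set} (ds : List (List X)) → All (Any P) ds ⇔ Any (All P) (choices ds)
All-Any⇔Any-All-choices [] = mk⇔ (λ _ → here All.[]) (λ _ → All.[])
All-Any⇔Any-All-choices (d ∷ ds) = mk⇔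
  (λ { (p∈d All.∷ ps) → AnyP.concatMap⁺ extend (Any.map (λ px → AnyP.map⁺ (Any.map (px All.∷_) (to IH ps))) p∈d) })
  (λ q → let x , x∈d , q′ = find (AnyP.concatMap⁻ extend q)
             q″ = AnyP.map⁻ q′
         in Any.map (λ { refl → All.head (proj₂ (Any.satisfied q″)) }) x∈d All.∷ from IH (Any.map All.tail q″))
  where
  IH = All-Any⇔Any-All-choices ds
  extend = λ x → L.map (x ∷_) (choices ds)

count : {X : Set} {P : X → Set} → (∀ x → Dec (P x)) → List X → ℕ
count P? []       = 0
count P? (x ∷ xs) with P? x
... | yes _ = suc (count P? xs)
... | no  _ = count P? xs

module _ {X : Set} {P Q : X → Set} (P? : ∀ x → Dec (P x)) (Q? : ∀ x → Dec (Q x)) (P⇒Q : ∀ {x} → P x → Q x) where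

  count-mono : ∀ xs → count P? xs ≤ count Q? xs
  count-mono []       = z≤n
  count-mono (x ∷ xs) with P? x | Q? x
  ... | yes _ | yes _ = s≤s (count-mono xs)
  ... | yes p | no ¬q = ⊥-elim (¬q (P⇒Q p))
  ... | no  _ | yes _ = m≤n⇒m≤1+n (count-mono xs)
  ... | no  _ | no  _ = count-mono xs

  count-mono-< : ∀ {y} xs → y ∈ xs → Q y → ¬ P y → count P? xs < count Q? xs
  count-mono-< (x ∷ xs) (here refl) qy ¬py with P? x | Q? x
  ... | yes p | _     = ⊥-elim (¬py p)
  ... | no  _ | yes _ = s≤s (count-mono xs)
  ... | no  _ | no ¬q = ⊥-elim (¬q qy)
  count-mono-< (x ∷ xs) (there y∈xs) qy ¬py with P? x | Q? x
  ... | yes _ | yes _ = s≤s (count-mono-< xs y∈xs qy ¬py)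
  ... | yes p | no ¬q = ⊥-elim (¬q (P⇒Q p))
  ... | no  _ | yes _ = m≤n⇒m≤1+n (count-mono-< xs y∈xs qy ¬py)
  ... | no  _ | no  _ = count-mono-< xs y∈xs qy ¬py

count≤length : {X : Set} {P : X → Set} (P? : ∀ x → Dec (P x)) → ∀ xs → count P? xs ≤ length xs
count≤length P? []       = z≤n
count≤length P? (x ∷ xs) with P? x
... | yes _ = s≤s (count≤length P? xs)
... | no  _ = m≤n⇒m≤1+n (count≤length P? xs)

module _ {A : Set} where

  map-subst : {B : Set} (f : A → B) {m n : ℕ} (e : m ≡ n) (v : Vec A m) → map f (subst (Vec A) e v) ≡ subst (Vec B) e (map f v)
  map-subst f refl v = refl

  subst-sym-trans : {m n o : ℕ} (e₁ : m ≡ n) (e₂ : n ≡ o) (v : Vec A o) →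
                    subst (Vec A) (sym (trans e₁ e₂)) v ≡ subst (Vec A) (sym e₁) (subst (Vec A) (sym e₂) v)
  subst-sym-trans refl refl v = refl

  take-++ : ∀ {m n} (v : Vec A m) (w : Vec A n) → V.take m (v ++ w) ≡ v
  take-++ []      w = refl
  take-++ (x ∷ v) w = cong (x ∷_) (take-++ v w)

  drop-++ : ∀ {m n} (v : Vec A m) (w : Vec A n) → V.drop m (v ++ w) ≡ w
  drop-++ []      w = refl
  drop-++ (x ∷ v) w = drop-++ v w

  subst-++-assoc : ∀ {n j l m} (e : n ≡ j + l) (e′ : n + m ≡ j + (l + m)) (y : Vec A j) (w : Vec A l) (t : Vec A m) →
                   subst (Vec A) (sym e′) (y ++ (w ++ t)) ≡ subst (Vec A) (sym e) (y ++ w) ++ t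
  subst-++-assoc refl e′ y w t = trans (VP.subst-is-cast (sym e′) _) (VP.cast-sym e′ (VP.++-assoc-eqFree y w t))

  ∀-++≢⇔≢drop : ∀ {k j l} (e : k ≡ j + l) (w : Vec A l) (z : Vec A k) →
                (∀ y → subst (Vec A) (sym e) (y ++ w) ≢ z) ⇔ (w ≢ V.drop j (subst (Vec A) e z))
  ∀-++≢⇔≢drop {j = j} refl w z = mk⇔
    (λ h eq → h (V.take j z) (trans (cong (V.take j z ++_) eq) (VP.take++drop≡id j z)))
    (λ h y eq → h (trans (sym (drop-++ y w)) (cong (V.drop j) eq)))

weaken : ∀ m {n} k → Fin (m + n) → Fin (m + (n + k))
weaken zero    k i       = i Fin.↑ˡ k
weaken (suc m) k zero    = zero
weaken (suc m) k (suc i) = suc (weaken m k i)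

lookup-weaken : ∀ {A : Set} {m n k} (u : Vec A m) (v : Vec A n) (w : Vec A k) i →
                lookup (u ++ (v ++ w)) (weaken m k i) ≡ lookup (u ++ v) i
lookup-weaken []      v w i       = VP.lookup-++ˡ v w i
lookup-weaken (x ∷ u) v w zero    = refl
lookup-weaken (x ∷ u) v w (suc i) = lookup-weaken u v w i

record Finite (A : Set) : Set where
  field
    elements : List A
    complete : ∀ x → x ∈ elements
open Finite

finite-Fin : ∀ n → Finite (Fin n)
finite-Fin n = record { elements = L.allFin n ; complete = ∈-allFin }

finite-Vec : {A : Set} → Finite A → ∀ k → Finite (Vec A k)
finite-Vec fin zero = record { elements = [] ∷ [] ; complete = λ { [] → here refl } }
finite-Vec fin (suc k) = record
  { elements = L.map (uncurry _∷_) (L.cartesianProduct (elements fin) (elements fin′))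
  ; complete = λ { (a ∷ v) → ∈-map⁺ (uncurry _∷_) (∈-cartesianProduct⁺ (complete fin a) (complete fin′ v)) }
  }
  where fin′ = finite-Vec fin k

finite-Σ : ∀ {n} {B : Fin n → Set} → (∀ i → Finite (B i)) → Finite (Σ (Fin n) B)
finite-Σ {n} fin = record
  { elements = L.concatMap fibre (L.allFin n)
  ; complete = λ { (i , b) → ∈-concatMap⁺ fibre (Any.map (λ { refl → ∈-map⁺ (i ,_) (complete (fin i) b) }) (∈-allFin i)) }
  }
  where fibre = λ i → L.map (i ,_) (elements (fin i))

module _ {X : Set} (fin : Finite X) {P : X → Set} (P? : ∀ x → Dec (P x)) where

  ∀? : Dec (∀ x → P x)
  ∀? = map′ (λ ps x → All.lookup ps (complete fin x)) (λ f → All.tabulate λ {x} _ → f x) (All.all? P? (elements fin))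

  ∃? : Dec (Σ X P)
  ∃? = map′ Any.satisfied (λ { (x , p) → Any.map (λ { refl → p }) (complete fin x) }) (Any.any? P? (elements fin))

dec-true⁻ : {P : Set} (P? : Dec P) → does P? ≡ true → P
dec-true⁻ (yes p) _ = p

χ : {A : Set} {k : ℕ} {P : Vec A k → Set} → (∀ v → Dec (P v)) → Rel A k
χ P? v = does (P? v)

χ-true : {A : Set} {k : ℕ} {P : Vec A k → Set} (P? : ∀ v → Dec (P v)) {v : Vec A k} → χ P? v ≡ true ⇔ P v
χ-true P? {v} = mk⇔ (dec-true⁻ (P? v)) (dec-true (P? v))

module _ {A : Set} {k : ℕ} where

  full : Rel A k
  full _ = true

  allBut : DecidableEquality A → Vec A k → Rel A k
  allBut _≟_ z = χ λ v → ¬? (VP.≡-dec _≟_ v z)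

  allBut-true : (_≟_ : DecidableEquality A) {z v : Vec A k} → allBut _≟_ z v ≡ true ⇔ (v ≢ z)
  allBut-true _≟_ {z} = χ-true λ v → ¬? (VP.≡-dec _≟_ v z)

module FirstOrderDecidable {σ : Vocab} {A : Set} (fin : Finite A) (_≟_ : DecidableEquality A) (𝒜 : Structure σ A) where

  AtomSem? : ∀ {n} (env : Vec A n) (a : Atom σ n) → Dec (AtomSem 𝒜 env a)
  AtomSem? env (relA R ts) = rel 𝒜 R (map (evalT 𝒜 env) ts) ≟ᵇ true
  AtomSem? env (eqA s t)   = evalT 𝒜 env s ≟ evalT 𝒜 env t

  LitSem? : ∀ {n} (env : Vec A n) (L : Literal σ n) → Dec (LitSem 𝒜 env L)
  LitSem? env (pos a) = AtomSem? env a
  LitSem? env (neg a) = ¬? (AtomSem? env a)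

  FormSem? : ∀ {n} (env : Vec A n) (φ : Formula σ n) → Dec (FormSem 𝒜 env φ)
  FormSem? env (atom a) = AtomSem? env a
  FormSem? env ⊤f       = yes tt
  FormSem? env ⊥f       = no λ ()
  FormSem? env (¬f φ)   = ¬? (FormSem? env φ)
  FormSem? env (φ ∧f ψ) = FormSem? env φ ×-dec FormSem? env ψ
  FormSem? env (φ ∨f ψ) = FormSem? env φ ⊎-dec FormSem? env ψ
  FormSem? env (φ ⇒f ψ) = FormSem? env φ →-dec FormSem? env ψ
  FormSem? env (∀f φ)   = ∀? fin λ a → FormSem? (a ∷ env) φ
  FormSem? env (∃f φ)   = ∃? fin λ a → FormSem? (a ∷ env) φ

module Renaming {σ : Vocab} where

  renT : ∀ {n n′} → (Fin n → Fin n′) → Term σ n → Term σ n′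
  renT ρ (var x) = var (ρ x)
  renT ρ (cst c) = cst c

  renA : ∀ {n n′} → (Fin n → Fin n′) → Atom σ n → Atom σ n′
  renA ρ (relA R ts) = relA R (map (renT ρ) ts)
  renA ρ (eqA s t)   = eqA (renT ρ s) (renT ρ t)

  renL : ∀ {n n′} → (Fin n → Fin n′) → Literal σ n → Literal σ n′
  renL ρ (pos a) = pos (renA ρ a)
  renL ρ (neg a) = neg (renA ρ a)

  lift : ∀ {n n′} → (Fin n → Fin n′) → Fin (suc n) → Fin (suc n′)
  lift ρ zero    = zero
  lift ρ (suc x) = suc (ρ x)

  renF : ∀ {n n′} → (Fin n → Fin n′) → Formula σ n → Formula σ n′
  renF ρ (atom a) = atom (renA ρ a)
  renF ρ ⊤f       = ⊤f
  renF ρ ⊥f       = ⊥f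
  renF ρ (¬f φ)   = ¬f (renF ρ φ)
  renF ρ (φ ∧f ψ) = renF ρ φ ∧f renF ρ ψ
  renF ρ (φ ∨f ψ) = renF ρ φ ∨f renF ρ ψ
  renF ρ (φ ⇒f ψ) = renF ρ φ ⇒f renF ρ ψ
  renF ρ (∀f φ)   = ∀f (renF (lift ρ) φ)
  renF ρ (∃f φ)   = ∃f (renF (lift ρ) φ)

  module _ {A : Set} (𝒜 : Structure σ A) where

    Compatible : ∀ {n n′} → (Fin n → Fin n′) → Vec A n → Vec A n′ → Set
    Compatible ρ env env′ = ∀ x → lookup env′ (ρ x) ≡ lookup env x

    Compatible-lift : ∀ {n n′} {ρ : Fin n → Fin n′} {env env′} → Compatible ρ env env′ →
                      ∀ a → Compatible (lift ρ) (a ∷ env) (a ∷ env′)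
    Compatible-lift c a zero    = refl
    Compatible-lift c a (suc x) = c x

    module _ {n n′} {ρ : Fin n → Fin n′} {env : Vec A n} {env′ : Vec A n′} (c : Compatible ρ env env′) where

      evalT-ren : ∀ t → evalT 𝒜 env′ (renT ρ t) ≡ evalT 𝒜 env t
      evalT-ren (var x) = c x
      evalT-ren (cst _) = refl

      map-evalT-ren : ∀ {k} (ts : Vec (Term σ n) k) → map (evalT 𝒜 env′) (map (renT ρ) ts) ≡ map (evalT 𝒜 env) ts
      map-evalT-ren ts = trans (sym (VP.map-∘ _ _ ts)) (VP.map-cong evalT-ren ts)

      AtomSem-ren : ∀ a → AtomSem 𝒜 env′ (renA ρ a) ≡ AtomSem 𝒜 env a
      AtomSem-ren (relA R ts) = cong (λ v → rel 𝒜 R v ≡ true) (map-evalT-ren ts)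
      AtomSem-ren (eqA s t)   = cong₂ _≡_ (evalT-ren s) (evalT-ren t)

      LitSem-ren : ∀ L → LitSem 𝒜 env′ (renL ρ L) ≡ LitSem 𝒜 env L
      LitSem-ren (pos a) = AtomSem-ren a
      LitSem-ren (neg a) = cong ¬_ (AtomSem-ren a)

    FormSem-ren : ∀ {n n′} {ρ : Fin n → Fin n′} {env env′} → Compatible ρ env env′ →
                  ∀ φ → FormSem 𝒜 env′ (renF ρ φ) ⇔ FormSem 𝒜 env φ
    FormSem-ren c (atom a) = ≡⇒⇔ (AtomSem-ren c a)
    FormSem-ren c ⊤f       = ⇔.refl
    FormSem-ren c ⊥f       = ⇔.refl
    FormSem-ren c (¬f φ)   = →-cong⇔ (FormSem-ren c φ) ⇔.refl
    FormSem-ren c (φ ∧f ψ) = ×-cong⇔ (FormSem-ren c φ) (FormSem-ren c ψ)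
    FormSem-ren c (φ ∨f ψ) = ⊎-cong⇔ (FormSem-ren c φ) (FormSem-ren c ψ)
    FormSem-ren c (φ ⇒f ψ) = →-cong⇔ (FormSem-ren c φ) (FormSem-ren c ψ)
    FormSem-ren c (∀f φ)   = Π-cong⇔ λ a → FormSem-ren (Compatible-lift c a) φ
    FormSem-ren c (∃f φ)   = Σ-cong⇔ λ a → FormSem-ren (Compatible-lift c a) φ

module Terms {σ : Vocab} where

  vars : ∀ {k n} → (Fin k → Fin n) → Vec (Term σ n) k
  vars f = V.tabulate (var ∘ f)

  map-evalT-vars : ∀ {A : Set} (𝒜 : Structure σ A) {k n} (f : Fin k → Fin n) (env : Vec A n) (v : Vec A k) →
                   (∀ i → lookup env (f i) ≡ lookup v i) → map (evalT 𝒜 env) (vars f) ≡ v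
  map-evalT-vars 𝒜 f env v h = begin
    map (evalT 𝒜 env) (V.tabulate (var ∘ f))  ≡⟨ VP.tabulate-∘ _ _ ⟨
    V.tabulate (lookup env ∘ f)               ≡⟨ VP.tabulate-cong h ⟩
    V.tabulate (lookup v)                     ≡⟨ VP.tabulate∘lookup v ⟩
    v                                         ∎
    where open ≡-Reasoning

  ≢-literals : ∀ {n k} → Vec (Term σ n) k → Vec (Term σ n) k → List (Literal σ n)
  ≢-literals []       []       = []
  ≢-literals (t ∷ ts) (z ∷ zs) = neg (eqA t z) ∷ ≢-literals ts zs

  ≡-literals : ∀ {n k} → Vec (Term σ n) k → Vec (Term σ n) k → List (Literal σ n)
  ≡-literals []       []       = []
  ≡-literals (t ∷ ts) (z ∷ zs) = pos (eqA t z) ∷ ≡-literals ts zs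

  module _ {A : Set} (_≟_ : DecidableEquality A) (𝒜 : Structure σ A) {n : ℕ} (env : Vec A n) where

    Any-≢-literals : ∀ {k} (ts zs : Vec (Term σ n) k) →
                     Any (LitSem 𝒜 env) (≢-literals ts zs) ⇔ (map (evalT 𝒜 env) ts ≢ map (evalT 𝒜 env) zs)
    Any-≢-literals []       []       = mk⇔ (λ ()) (λ ≢ → ⊥-elim (≢ refl))
    Any-≢-literals (t ∷ ts) (z ∷ zs) = mk⇔
      (λ { (here t≢z) eq → t≢z (VP.∷-injectiveˡ eq) ; (there p) eq → to IH p (VP.∷-injectiveʳ eq) })
      (λ ≢ → case (evalT 𝒜 env t ≟ evalT 𝒜 env z) ≢)
      where
      IH = Any-≢-literals ts zs
      case : Dec (evalT 𝒜 env t ≡ evalT 𝒜 env z) → map (evalT 𝒜 env) (t ∷ ts) ≢ map (evalT 𝒜 env) (z ∷ zs) →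
             Any (LitSem 𝒜 env) (≢-literals (t ∷ ts) (z ∷ zs))
      case (yes t≡z) ≢ = there (from IH λ eq → ≢ (cong₂ _∷_ t≡z eq))
      case (no t≢z)  ≢ = here t≢z

    All-≡-literals : ∀ {k} (ts zs : Vec (Term σ n) k) →
                     All (LitSem 𝒜 env) (≡-literals ts zs) ⇔ (map (evalT 𝒜 env) ts ≡ map (evalT 𝒜 env) zs)
    All-≡-literals []       []       = mk⇔ (λ _ → refl) (λ _ → All.[])
    All-≡-literals (t ∷ ts) (z ∷ zs) = mk⇔
      (λ { (t≡z All.∷ eqs) → cong₂ _∷_ t≡z (to IH eqs) })
      (λ eq → VP.∷-injectiveˡ eq All.∷ from IH (VP.∷-injectiveʳ eq))
      where IH = All-≡-literals ts zs

-- The least fixed point of a DATALOG program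

-- The chain C 0 ⊆ C 1 ⊆ ⋯ of decidable subsets of the finite X is generated by a monotone operator
-- (C-step), so it stays put once it stops growing, and it can grow at most |X| times.
module AscendingChain {X : Set} (fin : Finite X) (C : ℕ → X → Set) (C? : ∀ i x → Dec (C i x))
                      (C-suc : ∀ {i x} → C i x → C (suc i) x)
                      (C-step : ∀ {i j} → (∀ {x} → C i x → C j x) → ∀ {x} → C (suc i) x → C (suc j) x) where

  Stable : ℕ → Set
  Stable i = ∀ {x} → C (suc i) x → C i x

  size : ℕ → ℕ
  size i = count (C? i) (elements fin)

  stable-or-size≥ : ∀ n → (Σ ℕ λ i → i ≤ n × Stable i) ⊎ n ≤ size n
  stable-or-size≥ zero = inj₂ z≤n
  stable-or-size≥ (suc n) with stable-or-size≥ n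
  ... | inj₁ (i , i≤n , st) = inj₁ (i , m≤n⇒m≤1+n i≤n , st)
  ... | inj₂ n≤size with ∃? fin (λ x → C? (suc n) x ×-dec ¬? (C? n x))
  ...   | yes (x , new , ¬old) =
          inj₂ (≤-trans (s≤s n≤size) (count-mono-< (C? n) (C? (suc n)) C-suc (elements fin) (complete fin x) new ¬old))
  ...   | no ¬new = inj₁ (n , n≤1+n n , λ {x} new → decidable-stable (C? n x) (λ ¬old → ¬new (x , new , ¬old)))

  bound : ℕ
  bound = suc (length (elements fin))

  stabilises : Σ ℕ λ i → i ≤ bound × Stable i
  stabilises with stable-or-size≥ bound
  ... | inj₁ st = st
  ... | inj₂ bound≤size = ⊥-elim (<-irrefl refl (≤-trans bound≤size (count≤length (C? bound) (elements fin))))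

  C-+ : ∀ d {i x} → C i x → C (d + i) x
  C-+ zero    c = c
  C-+ (suc d) c = C-suc (C-+ d c)

  C-≤ : ∀ {i j x} → i ≤ j → C i x → C j x
  C-≤ {i} {j} {x} i≤j c = subst (λ k → C k x) (m∸n+n≡m i≤j) (C-+ (j ∸ i) c)

  stable-forever : ∀ {i} → Stable i → ∀ d {x} → C (d + i) x → C i x
  stable-forever st zero    c = c
  stable-forever st (suc d) c = st (C-step (stable-forever st d) c)

  reached-by-bound : ∀ {j x} → C j x → C bound x
  reached-by-bound {j} {x} c with ≤-total j bound | stabilises
  ... | inj₁ j≤bound | _ = C-≤ j≤bound c
  ... | inj₂ bound≤j | i , i≤bound , st =
        C-≤ i≤bound (stable-forever st (j ∸ i) (subst (λ k → C k x) (sym (m∸n+n≡m (≤-trans i≤bound bound≤j))) c))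

module Fixpoint {s u : Bool} {σ : Vocab} {I : ℕ} {iar : Fin I → ℕ} {A : Set}
                (fin : Finite A) (_≟_ : DecidableEquality A) (𝒜 : Structure σ A)
                (rules : List (Rule s u σ I iar)) where

  open FirstOrderDecidable fin _≟_ 𝒜

  IRel : Set₁
  IRel = (p : Fin I) → Vec A (iar p) → Set

  _⊆_ : IRel → IRel → Set
  J ⊆ J′ = ∀ {p a} → J p a → J′ p a

  BodySem-mono : ∀ {J J′ n} → J ⊆ J′ → (env : Vec A n) (b : Body s u σ I iar n) →
                 BodySem 𝒜 J env b → BodySem 𝒜 J′ env b
  BodySem-mono J⊆J′ env (iatom p _ ts)        x = J⊆J′ x
  BodySem-mono J⊆J′ env (elit L)              x = x
  BodySem-mono J⊆J′ env (efo _ φ)             x = x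
  BodySem-mono J⊆J′ env (iuniv _ p _ j l e z) x = J⊆J′ ∘ x

  BodiesSem-mono : ∀ {J J′ n} → J ⊆ J′ → (env : Vec A n) {bs : List (Body s u σ I iar n)} →
                   All (BodySem 𝒜 J env) bs → All (BodySem 𝒜 J′ env) bs
  BodiesSem-mono J⊆J′ env = All.map (λ {b} → BodySem-mono J⊆J′ env b)

  Derives-mono : ∀ {J J′} → J ⊆ J′ → Derives 𝒜 rules J ⊆ Derives 𝒜 rules J′
  Derives-mono J⊆J′ (fire ρ ρ∈ env bs) = fire ρ ρ∈ env (BodiesSem-mono J⊆J′ env bs)

  Stage-suc : ∀ i → Stage 𝒜 rules i ⊆ Stage 𝒜 rules (suc i)
  Stage-suc zero    ()
  Stage-suc (suc i) = Derives-mono (Stage-suc i)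

  Closed : IRel → Set
  Closed J = ∀ ρ → ρ ∈ rules → (env : Vec A (Rule.nv ρ)) → All (BodySem 𝒜 J env) (Rule.body ρ) →
             J (Rule.hd ρ) (map (evalT 𝒜 env) (Rule.hargs ρ))

  Fix : IRel
  Fix p a = Σ ℕ λ i → Stage 𝒜 rules i p a

  Stage⊆Closed : ∀ {J} → Closed J → ∀ i → Stage 𝒜 rules i ⊆ J
  Stage⊆Closed cl zero    ()
  Stage⊆Closed cl (suc i) (fire ρ ρ∈ env bs) = cl ρ ρ∈ env (BodiesSem-mono (Stage⊆Closed cl i) env bs)

  Fix-least : ∀ {J} → Closed J → Fix ⊆ J
  Fix-least cl (i , x) = Stage⊆Closed cl i x

  Point : Set
  Point = Σ (Fin I) λ p → Vec A (iar p)

  conclusion : (ρ : Rule s u σ I iar) → Vec A (Rule.nv ρ) → Point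
  conclusion ρ env = Rule.hd ρ , map (evalT 𝒜 env) (Rule.hargs ρ)

  Fires : IRel → Point → Rule s u σ I iar → Set
  Fires J x ρ = Σ (Vec A (Rule.nv ρ)) λ env → All (BodySem 𝒜 J env) (Rule.body ρ) × conclusion ρ env ≡ x

  Derives⇔Fires : ∀ {J p a} → Derives 𝒜 rules J p a ⇔ Any (Fires J (p , a)) rules
  Derives⇔Fires {J} = mk⇔
    (λ { (fire ρ ρ∈ env bs) → lose ρ∈ (env , bs , refl) })
    (λ fires → derive (find fires))
    where
    derive : ∀ {x} → Σ _ (λ ρ → ρ ∈ rules × Fires J x ρ) → uncurry (Derives 𝒜 rules J) x
    derive (ρ , ρ∈ , env , bs , refl) = fire ρ ρ∈ env bs

  DecIRel : IRel → Set
  DecIRel J = ∀ p a → Dec (J p a)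

  BodySem? : ∀ {J n} → DecIRel J → (env : Vec A n) (b : Body s u σ I iar n) → Dec (BodySem 𝒜 J env b)
  BodySem? J? env (iatom p _ ts)        = J? p _
  BodySem? J? env (elit L)              = LitSem? env L
  BodySem? J? env (efo _ φ)             = FormSem? env φ
  BodySem? J? env (iuniv _ p _ j l e z) = ∀? (finite-Vec fin j) λ _ → J? p _

  Derives? : ∀ {J} → DecIRel J → DecIRel (Derives 𝒜 rules J)
  Derives? J? p a = map′ (from Derives⇔Fires) (to Derives⇔Fires) (Any.any? fires? rules)
    where
    fires? : ∀ ρ → Dec (Fires _ (p , a) ρ)
    fires? ρ = ∃? (finite-Vec fin (Rule.nv ρ)) λ env →
      All.all? (BodySem? J? env) (Rule.body ρ) ×-dec ΣP.≡-dec Fin._≟_ (VP.≡-dec _≟_) (conclusion ρ env) (p , a)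

  Stage? : ∀ i → DecIRel (Stage 𝒜 rules i)
  Stage? zero    p a = no λ ()
  Stage? (suc i)     = Derives? (Stage? i)

  open AscendingChain (finite-Σ λ p → finite-Vec fin (iar p)) (λ i (p , a) → Stage 𝒜 rules i p a)
                      (λ i (p , a) → Stage? i p a) (Stage-suc _) (λ i⊆j → Derives-mono i⊆j)
    using (bound; reached-by-bound)

  Fix? : DecIRel Fix
  Fix? p a = map′ (bound ,_) (λ (i , x) → reached-by-bound x) (Stage? bound p a)

  Fix-closed : Closed Fix
  Fix-closed ρ ρ∈ env bs = suc bound , fire ρ ρ∈ env (BodiesSem-mono (λ (i , x) → reached-by-bound x) env bs)

-- Horn clauses over a signature of relation variables

record Signature : Set₁ where
  constructor sig
  field
    Sym : Set
    ar  : Sym → ℕ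
open Signature

infixl 6 _⊕_
infix  4 _⇒ˢ_

_⊕_ : Signature → Signature → Signature
Γ ⊕ Δ = sig (Sym Γ ⊎ Sym Δ) [ ar Γ , ar Δ ]′

∅ : Signature
∅ = sig ⊥ λ ()

single : ℕ → Signature
single a = sig ⊤ λ _ → a

Interp : Signature → Set → Set
Interp Γ A = (x : Sym Γ) → Rel A (ar Γ x)

⟨_,_⟩ : ∀ {Γ Δ A} → Interp Γ A → Interp Δ A → Interp (Γ ⊕ Δ) A
⟨ I , J ⟩ (inj₁ x) = I x
⟨ I , J ⟩ (inj₂ y) = J y

module _ {Γ : Signature} {A : Set} where

  _⊑_ : Interp Γ A → Interp Γ A → Set
  I ⊑ J = ∀ x v → I x v ≡ true → J x v ≡ true

  _≐_ : Interp Γ A → Interp Γ A → Set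
  I ≐ J = ∀ x v → I x v ≡ J x v

  ≐⇒⊑ : ∀ {I J} → I ≐ J → I ⊑ J
  ≐⇒⊑ I≐J x v = trans (sym (I≐J x v))

  ≐-sym : ∀ {I J} → I ≐ J → J ≐ I
  ≐-sym I≐J x v = sym (I≐J x v)

record _⇒ˢ_ (Γ Δ : Signature) : Set where
  field
    ren    : Sym Γ → Sym Δ
    ar-ren : ∀ x → ar Δ (ren x) ≡ ar Γ x
open _⇒ˢ_

pull : ∀ {Γ Δ A} → Γ ⇒ˢ Δ → Interp Δ A → Interp Γ A
pull {A = A} f J x v = J (ren f x) (subst (Vec A) (sym (ar-ren f x)) v)

infixl 7 _⁺_

_⁺_ : Signature → ℕ → Signature
Γ ⁺ a = sig (Sym Γ) λ x → ar Γ x + a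

module Horn (s u : Bool) (σ : Vocab) (r : ℕ) where

  data HAtom (Γ : Signature) (n : ℕ) : Set where
    hrel  : (x : Sym Γ) → Vec (Term σ n) (ar Γ x) → HAtom Γ n
    huniv : T u → (x : Sym Γ) (j l : ℕ) → ar Γ x ≡ j + l → Vec (Term σ n) l → HAtom Γ n

  data Condition (n : ℕ) : Set where
    lit : Literal σ n → Condition n
    fo  : T s → Formula σ n → Condition n

  HHead : Signature → ℕ → Set
  HHead Γ n = Maybe (Σ (Sym Γ) λ x → Vec (Term σ n) (ar Γ x))

  -- Variables 0, …, r − 1 are the free variables of the formula; the other n are universally quantified.
  record HClause (Γ : Signature) : Set where
    constructor clause
    field
      n     : ℕ
      atoms : List (HAtom Γ (r + n))
      conds : List (Condition (r + n))
      head  : HHead Γ (r + n)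

  module _ {A : Set} (𝒜 : Structure σ A) where

    HAtomSem : ∀ {Γ n} → Interp Γ A → Vec A n → HAtom Γ n → Set
    HAtomSem I env (hrel x ts)          = I x (map (evalT 𝒜 env) ts) ≡ true
    HAtomSem I env (huniv _ x j l e zs) = (b : Vec A j) → I x (subst (Vec A) (sym e) (b ++ map (evalT 𝒜 env) zs)) ≡ true

    CondSem : ∀ {n} → Vec A n → Condition n → Set
    CondSem env (lit L)  = LitSem 𝒜 env L
    CondSem env (fo _ φ) = FormSem 𝒜 env φ

    HHeadSem : ∀ {Γ n} → Interp Γ A → Vec A n → HHead Γ n → Set
    HHeadSem I env nothing         = ⊥
    HHeadSem I env (just (x , ts)) = I x (map (evalT 𝒜 env) ts) ≡ true

    HClauseSemAt : ∀ {Γ} → Interp Γ A → Vec A r → (C : HClause Γ) → Vec A (HClause.n C) → Set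
    HClauseSemAt I ā (clause n αs βs h) b =
      All (HAtomSem I (ā ++ b)) αs → All (CondSem (ā ++ b)) βs → HHeadSem I (ā ++ b) h

    HClauseSem : ∀ {Γ} → Interp Γ A → Vec A r → HClause Γ → Set
    HClauseSem I ā C = ∀ b → HClauseSemAt I ā C b

    module _ {Γ : Signature} {I J : Interp Γ A} (I⊑J : I ⊑ J) where

      HAtomSem-mono : ∀ {n} (env : Vec A n) α → HAtomSem I env α → HAtomSem J env α
      HAtomSem-mono env (hrel x ts)          = I⊑J x _
      HAtomSem-mono env (huniv _ x j l e zs) = λ h b → I⊑J x _ (h b)

      HAtomsSem-mono : ∀ {n} (env : Vec A n) {αs} → All (HAtomSem I env) αs → All (HAtomSem J env) αs
      HAtomsSem-mono env = All.map (λ {α} → HAtomSem-mono env α)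

      HHeadSem-mono : ∀ {n} (env : Vec A n) h → HHeadSem I env h → HHeadSem J env h
      HHeadSem-mono env nothing         = λ ()
      HHeadSem-mono env (just (x , ts)) = I⊑J x _

    HClauseSem-cong : ∀ {Γ} {I J : Interp Γ A} → I ≐ J → ∀ {ā} C → HClauseSem I ā C → HClauseSem J ā C
    HClauseSem-cong I≐J {ā} (clause n αs βs h) C b αs-hold βs-hold =
      HHeadSem-mono (≐⇒⊑ I≐J) (ā ++ b) h (C b (HAtomsSem-mono (≐⇒⊑ (≐-sym I≐J)) (ā ++ b) αs-hold) βs-hold)

    HClausesSem-cong : ∀ {Γ} {I J : Interp Γ A} → I ≐ J → ∀ {ā Cs} → All (HClauseSem I ā) Cs → All (HClauseSem J ā) Cs
    HClausesSem-cong I≐J = All.map (λ {C} → HClauseSem-cong I≐J C)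

    -- The index k₀ makes the family nonempty, which is needed for clauses with head ⊥.
    HClauseSem-⋂ : ∀ {Γ} {K : Set} (k₀ : K) (J : K → Interp Γ A) (I : Interp Γ A) →
                   (∀ x v → I x v ≡ true ⇔ (∀ k → J k x v ≡ true)) →
                   ∀ {ā} C → (∀ k → HClauseSem (J k) ā C) → HClauseSem I ā C
    HClauseSem-⋂ k₀ J I I≡⋂J {ā} (clause n αs βs h) C b αs-hold βs-hold = meet h (λ k → C k b (αs-in k) βs-hold)
      where
      αs-in : ∀ k → All (HAtomSem (J k) (ā ++ b)) αs
      αs-in k = HAtomsSem-mono (λ x v → λ Ixv → to (I≡⋂J x v) Ixv k) (ā ++ b) αs-hold
      meet : ∀ h → (∀ k → HHeadSem (J k) (ā ++ b) h) → HHeadSem I (ā ++ b) h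
      meet nothing         hs = hs k₀
      meet (just (x , ts)) hs = from (I≡⋂J x _) hs

  module _ {Γ Δ : Signature} (f : Γ ⇒ˢ Δ) where

    renameHAtom : ∀ {n} → HAtom Γ n → HAtom Δ n
    renameHAtom (hrel x ts)          = hrel (ren f x) (subst (Vec (Term σ _)) (sym (ar-ren f x)) ts)
    renameHAtom (huniv t x j l e zs) = huniv t (ren f x) j l (trans (ar-ren f x) e) zs

    renameHHead : ∀ {n} → HHead Γ n → HHead Δ n
    renameHHead nothing         = nothing
    renameHHead (just (x , ts)) = just (ren f x , subst (Vec (Term σ _)) (sym (ar-ren f x)) ts)

    rename : HClause Γ → HClause Δ
    rename (clause n αs βs h) = clause n (L.map renameHAtom αs) βs (renameHHead h)

    module _ {A : Set} (𝒜 : Structure σ A) (J : Interp Δ A) where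

      HAtomSem-rename : ∀ {n} (env : Vec A n) α → HAtomSem 𝒜 J env (renameHAtom α) ⇔ HAtomSem 𝒜 (pull f J) env α
      HAtomSem-rename env (hrel x ts) = ≡⇒⇔ (cong (λ v → J (ren f x) v ≡ true) (map-subst (evalT 𝒜 env) _ ts))
      HAtomSem-rename env (huniv t x j l e zs) = mk⇔
        (λ h b → subst (λ v → J (ren f x) v ≡ true) (subst-sym-trans (ar-ren f x) e _) (h b))
        (λ h b → subst (λ v → J (ren f x) v ≡ true) (sym (subst-sym-trans (ar-ren f x) e _)) (h b))

      HHeadSem-rename : ∀ {n} (env : Vec A n) h → HHeadSem 𝒜 J env (renameHHead h) ⇔ HHeadSem 𝒜 (pull f J) env h
      HHeadSem-rename env nothing         = ⇔.refl
      HHeadSem-rename env (just (x , ts)) = ≡⇒⇔ (cong (λ v → J (ren f x) v ≡ true) (map-subst (evalT 𝒜 env) _ ts))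

      HClauseSem-rename : ∀ ā C → HClauseSem 𝒜 J ā (rename C) ⇔ HClauseSem 𝒜 (pull f J) ā C
      HClauseSem-rename ā (clause n αs βs h) = mk⇔
        (λ C b αs-hold βs-hold → to (head⇔ b) (C b (from (atoms⇔ b) αs-hold) βs-hold))
        (λ C b αs-hold βs-hold → from (head⇔ b) (C b (to (atoms⇔ b) αs-hold) βs-hold))
        where
        atoms⇔ : ∀ b → All (HAtomSem 𝒜 J (ā ++ b)) (L.map renameHAtom αs) ⇔ All (HAtomSem 𝒜 (pull f J) (ā ++ b)) αs
        atoms⇔ b = ⇔.trans All-map⇔ (All-cong⇔ (HAtomSem-rename (ā ++ b)))
        head⇔ : ∀ b → HHeadSem 𝒜 J (ā ++ b) (renameHHead h) ⇔ HHeadSem 𝒜 (pull f J) (ā ++ b) h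
        head⇔ b = HHeadSem-rename (ā ++ b) h

      HClausesSem-rename : ∀ ā Cs → All (HClauseSem 𝒜 J ā) (L.map rename Cs) ⇔ All (HClauseSem 𝒜 (pull f J) ā) Cs
      HClausesSem-rename ā Cs = ⇔.trans All-map⇔ (All-cong⇔ (HClauseSem-rename ā))

-- Quantifier prefixes and the existential normal form

QSem-cong : ∀ Q {B : Set} {P P′ : B → Set} → (∀ b → P b ⇔ P′ b) → QSem Q P ⇔ QSem Q P′
QSem-cong ∀q = Π-cong⇔
QSem-cong ∃q = Σ-cong⇔

PrefixSem-cong : ∀ {A} m q ar {B B′ : ((i : Fin m) → Rel A (ar i)) → Set} → (∀ Rs → B Rs ⇔ B′ Rs) →
                 PrefixSem A m q ar B ⇔ PrefixSem A m q ar B′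
PrefixSem-cong zero    q ar B⇔B′ = B⇔B′ _
PrefixSem-cong (suc m) q ar B⇔B′ = QSem-cong (q zero) λ R₀ → PrefixSem-cong m (q ∘ suc) (ar ∘ suc) λ Rs → B⇔B′ _

PrefixSem-∃ : ∀ {A} m ar {B : ((i : Fin m) → Rel A (ar i)) → Set} →
              (∀ {Rs Rs′} → (∀ i v → Rs i v ≡ Rs′ i v) → B Rs → B Rs′) →
              PrefixSem A m (λ _ → ∃q) ar B ⇔ Σ _ B
PrefixSem-∃ zero    ar B-cong = mk⇔ (λ b → (λ ()) , b) (λ (_ , b) → B-cong (λ ()) b)
PrefixSem-∃ (suc m) ar B-cong = mk⇔
  (λ (R₀ , p) → _ , proj₂ (to (IH R₀) p))
  (λ (Rs , b) → Rs zero , from (IH (Rs zero)) (Rs ∘ suc , B-cong (λ { zero v → refl ; (suc i) v → refl }) b))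
  where
  IH = λ R₀ → PrefixSem-∃ m (ar ∘ suc) λ Rs≐Rs′ → B-cong λ { zero v → refl ; (suc i) v → Rs≐Rs′ i v }

record Encoding (X : Set) : Set where
  field
    size          : ℕ
    encode        : X → Fin size
    decode        : Fin size → X
    decode-encode : ∀ x → decode (encode x) ≡ x
open Encoding

encoding-Fin : ∀ n → Encoding (Fin n)
encoding-Fin n = record { size = n ; encode = λ i → i ; decode = λ i → i ; decode-encode = λ _ → refl }

encoding-⊤ : Encoding ⊤
encoding-⊤ = record { size = 1 ; encode = λ _ → zero ; decode = λ _ → tt ; decode-encode = λ _ → refl }

encoding-⊎ : {X Y : Set} → Encoding X → Encoding Y → Encoding (X ⊎ Y)
encoding-⊎ cX cY = record
  { size          = size cX + size cY
  ; encode        = λ { (inj₁ x) → encode cX x Fin.↑ˡ size cY ; (inj₂ y) → size cX Fin.↑ʳ encode cY y }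
  ; decode        = λ i → [ inj₁ ∘ decode cX , inj₂ ∘ decode cY ]′ (Fin.splitAt (size cX) i)
  ; decode-encode = λ
      { (inj₁ x) → trans (cong [ inj₁ ∘ decode cX , inj₂ ∘ decode cY ]′ (splitAt-↑ˡ _ (encode cX x) _))
                         (cong inj₁ (decode-encode cX x))
      ; (inj₂ y) → trans (cong [ inj₁ ∘ decode cX , inj₂ ∘ decode cY ]′ (splitAt-↑ʳ (size cX) _ (encode cY y)))
                         (cong inj₂ (decode-encode cY y)) }
  }

module NormalForm (s u : Bool) (σ : Vocab) (r : ℕ) where
  open Horn s u σ r
  open Renaming {σ}
  open Terms {σ}

  record ExForm (Γ : Signature) : Set₁ where
    field
      Ex       : Signature
      encoding : Encoding (Sym Ex)
      clauses  : List (HClause (Γ ⊕ Ex))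
  open ExForm

  ExSem : ∀ {Γ A} → Structure σ A → ExForm Γ → Interp Γ A → Vec A r → Set
  ExSem {A = A} 𝒜 E ρ ā = Σ (Interp (Ex E) A) λ S → All (HClauseSem 𝒜 ⟨ ρ , S ⟩ ā) (clauses E)

  const : ∀ {a A} → Rel A a → Interp (single a) A
  const R _ = R

  module _ {Γ : Signature} {a : ℕ} where

    reassoc : ∀ {Ex} → (Γ ⊕ single a) ⊕ Ex ⇒ˢ Γ ⊕ (single a ⊕ Ex)
    reassoc = record
      { ren    = λ { (inj₁ (inj₁ x)) → inj₁ x ; (inj₁ (inj₂ t)) → inj₂ (inj₁ t) ; (inj₂ y) → inj₂ (inj₂ y) }
      ; ar-ren = λ { (inj₁ (inj₁ x)) → refl ; (inj₁ (inj₂ t)) → refl ; (inj₂ y) → refl }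
      }

    absorb-∃ : ExForm (Γ ⊕ single a) → ExForm Γ
    absorb-∃ E = record
      { Ex       = single a ⊕ Ex E
      ; encoding = encoding-⊎ encoding-⊤ (encoding E)
      ; clauses  = L.map (rename reassoc) (clauses E)
      }

    absorb-∃-sem : ∀ {A} (𝒜 : Structure σ A) (E : ExForm (Γ ⊕ single a)) ρ ā →
                   (Σ (Rel A a) λ R → ExSem 𝒜 E ⟨ ρ , const R ⟩ ā) ⇔ ExSem 𝒜 (absorb-∃ E) ρ ā
    absorb-∃-sem 𝒜 E ρ ā = mk⇔
      (λ (R , S , H) → ⟨ const R , S ⟩ , from renamed (HClausesSem-cong 𝒜 into H))
      (λ (S , H) → S (inj₁ tt) , S ∘ inj₂ , HClausesSem-cong 𝒜 out (to renamed H))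
      where
      renamed : ∀ {S} → All (HClauseSem 𝒜 ⟨ ρ , S ⟩ ā) (clauses (absorb-∃ E)) ⇔
                        All (HClauseSem 𝒜 (pull reassoc ⟨ ρ , S ⟩) ā) (clauses E)
      renamed = HClausesSem-rename reassoc 𝒜 _ ā (clauses E)
      into : ∀ {R S} → ⟨ ⟨ ρ , const R ⟩ , S ⟩ ≐ pull reassoc ⟨ ρ , ⟨ const R , S ⟩ ⟩
      into (inj₁ (inj₁ x)) v = refl
      into (inj₁ (inj₂ t)) v = refl
      into (inj₂ y)        v = refl
      out : ∀ {S} → pull reassoc ⟨ ρ , S ⟩ ≐ ⟨ ⟨ ρ , const (S (inj₁ tt)) ⟩ , S ∘ inj₂ ⟩
      out (inj₁ (inj₁ x))  v = refl
      out (inj₁ (inj₂ tt)) v = refl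
      out (inj₂ y)         v = refl

  -- R := everything drops the atoms of R.  R := all tuples but z̄, for a block z̄ of a fresh variables, turns
  -- R t̄ in a body into the disjunction of the t̄ᵢ ≠ z̄ᵢ (which splits the clause), turns a head R t̄ into
  -- t̄ = z̄ in the body, and gives each existential relation the extra arguments z̄.
  module ∀-Elimination {Γ : Signature} {a : ℕ} (Ex : Signature) where

    Src Tgt : Signature
    Src = Γ ⊕ single a ⊕ Ex
    Tgt = Γ ⊕ (Ex ⊕ Ex ⁺ a)

    fullAtom : ∀ {n} → HAtom Src n → List (HAtom Tgt n)
    fullAtom (hrel (inj₁ (inj₁ x)) ts)          = hrel (inj₁ x) ts ∷ []
    fullAtom (hrel (inj₁ (inj₂ _)) _)           = []
    fullAtom (hrel (inj₂ y) ts)                 = hrel (inj₂ (inj₁ y)) ts ∷ []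
    fullAtom (huniv t (inj₁ (inj₁ x)) j l e ws) = huniv t (inj₁ x) j l e ws ∷ []
    fullAtom (huniv t (inj₁ (inj₂ _)) j l e ws) = []
    fullAtom (huniv t (inj₂ y) j l e ws)        = huniv t (inj₂ (inj₁ y)) j l e ws ∷ []

    fullClause : ∀ n → List (HAtom Src (r + n)) → List (Condition (r + n)) → HHead Tgt (r + n) → HClause Tgt
    fullClause n αs βs h = clause n (L.concatMap fullAtom αs) βs h

    fullClauses : HClause Src → List (HClause Tgt)
    fullClauses (clause n αs βs nothing)                     = fullClause n αs βs nothing ∷ []
    fullClauses (clause n αs βs (just (inj₁ (inj₁ x) , ts))) = fullClause n αs βs (just (inj₁ x , ts)) ∷ []
    fullClauses (clause n αs βs (just (inj₁ (inj₂ _) , _)))  = []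
    fullClauses (clause n αs βs (just (inj₂ y , ts)))        = fullClause n αs βs (just (inj₂ (inj₁ y) , ts)) ∷ []

    W : ∀ {n k} → Vec (Term σ (r + n)) k → Vec (Term σ (r + (n + a))) k
    W = map (renT (weaken r a))

    zvars : ∀ n → Vec (Term σ (r + (n + a))) a
    zvars n = vars λ j → r Fin.↑ʳ (n Fin.↑ʳ j)

    allButAtom : ∀ n → HAtom Src (r + n) → List (HAtom Tgt (r + (n + a))) × List (List (Literal σ (r + (n + a))))
    allButAtom n (hrel (inj₁ (inj₁ x)) ts)          = hrel (inj₁ x) (W ts) ∷ [] , []
    allButAtom n (hrel (inj₁ (inj₂ _)) ts)          = [] , ≢-literals (W ts) (zvars n) ∷ []
    allButAtom n (hrel (inj₂ y) ts)                 = hrel (inj₂ (inj₂ y)) (W ts ++ zvars n) ∷ [] , []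
    allButAtom n (huniv t (inj₁ (inj₁ x)) j l e ws) = huniv t (inj₁ x) j l e (W ws) ∷ [] , []
    allButAtom n (huniv t (inj₁ (inj₂ _)) j l e ws) = [] , ≢-literals (W ws) (V.drop j (subst (Vec _) e (zvars n))) ∷ []
    allButAtom n (huniv t (inj₂ y) j l e ws)        =
      huniv t (inj₂ (inj₂ y)) j (l + a) (trans (cong (_+ a) e) (+-assoc j l a)) (W ws ++ zvars n) ∷ [] , []

    allButHead : ∀ n → HHead Src (r + n) → HHead Tgt (r + (n + a)) × List (Literal σ (r + (n + a)))
    allButHead n nothing                     = nothing , []
    allButHead n (just (inj₁ (inj₁ x) , ts)) = just (inj₁ x , W ts) , []
    allButHead n (just (inj₁ (inj₂ _) , ts)) = nothing , ≡-literals (W ts) (zvars n)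
    allButHead n (just (inj₂ y , ts))        = just (inj₂ (inj₂ y) , W ts ++ zvars n) , []

    allButCond : ∀ n → Condition (r + n) → Condition (r + (n + a))
    allButCond n (lit L)  = lit (renL (weaken r a) L)
    allButCond n (fo t φ) = fo t (renF (weaken r a) φ)

    allButDisjunctions : ∀ n → List (HAtom Src (r + n)) → List (List (Literal σ (r + (n + a))))
    allButDisjunctions n = L.concatMap (proj₂ ∘ allButAtom n)

    allButClause : ∀ n → List (HAtom Src (r + n)) → List (Condition (r + n)) → HHead Src (r + n) →
               List (Literal σ (r + (n + a))) → HClause Tgt
    allButClause n αs βs h ch =
      clause (n + a) (L.concatMap (proj₁ ∘ allButAtom n) αs)
             (L.map (allButCond n) βs L.++ L.map lit (proj₂ (allButHead n h) L.++ ch)) (proj₁ (allButHead n h))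

    allButClauses : HClause Src → List (HClause Tgt)
    allButClauses (clause n αs βs h) = L.map (allButClause n αs βs h) (choices (allButDisjunctions n αs))

  eliminate-∀ : ∀ {Γ a} → ExForm (Γ ⊕ single a) → ExForm Γ
  eliminate-∀ {a = a} E = record
    { Ex       = Ex E ⊕ Ex E ⁺ a
    ; encoding = encoding-⊎ (encoding E) (encoding E)
    ; clauses  = L.concatMap (λ C → fullClauses C L.++ allButClauses C) (clauses E)
    }
    where open ∀-Elimination (Ex E)

  module ∀-EliminationSem {Γ : Signature} {a : ℕ} (Ex : Signature) {A : Set} (_≟_ : DecidableEquality A)
                          (𝒜 : Structure σ A) (ρ : Interp Γ A) (ā : Vec A r) (S : Interp (Ex ⊕ Ex ⁺ a) A) where
    open ∀-Elimination {Γ} {a} Ex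

    Itgt : Interp Tgt A
    Itgt = ⟨ ρ , S ⟩

    Ifull : Interp Src A
    Ifull = ⟨ ⟨ ρ , const full ⟩ , S ∘ inj₁ ⟩

    IallBut : Vec A a → Interp Src A
    IallBut z = ⟨ ⟨ ρ , const (allBut _≟_ z) ⟩ , (λ y v → S (inj₂ y) (v ++ z)) ⟩

    fullAtom-sem : ∀ {n} (env : Vec A n) α → HAtomSem 𝒜 Ifull env α ⇔ All (HAtomSem 𝒜 Itgt env) (fullAtom α)
    fullAtom-sem env (hrel (inj₁ (inj₁ x)) ts)          = ⇔.sym All-singleton⇔
    fullAtom-sem env (hrel (inj₁ (inj₂ _)) _)           = mk⇔ (λ _ → All.[]) (λ _ → refl)
    fullAtom-sem env (hrel (inj₂ y) ts)                 = ⇔.sym All-singleton⇔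
    fullAtom-sem env (huniv t (inj₁ (inj₁ x)) j l e ws) = ⇔.sym All-singleton⇔
    fullAtom-sem env (huniv t (inj₁ (inj₂ _)) j l e ws) = mk⇔ (λ _ → All.[]) (λ _ _ → refl)
    fullAtom-sem env (huniv t (inj₂ y) j l e ws)        = ⇔.sym All-singleton⇔

    fullClause-sem : ∀ n αs βs h h′ → (∀ {env} → HHeadSem 𝒜 Ifull env h ≡ HHeadSem 𝒜 Itgt env h′) →
                     HClauseSem 𝒜 Ifull ā (clause n αs βs h) ⇔ All (HClauseSem 𝒜 Itgt ā) (fullClause n αs βs h′ ∷ [])
    fullClause-sem n αs βs h h′ h≡h′ = ⇔.trans (Π-cong⇔ λ b →
      →-cong⇔ (⇔.trans (All-cong⇔ (fullAtom-sem (ā ++ b))) (⇔.sym (All-concatMap⇔ fullAtom)))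
              (→-cong⇔ ⇔.refl (≡⇒⇔ h≡h′)))
      (⇔.sym All-singleton⇔)

    fullClauses-sem : ∀ C → HClauseSem 𝒜 Ifull ā C ⇔ All (HClauseSem 𝒜 Itgt ā) (fullClauses C)
    fullClauses-sem (clause n αs βs nothing)                     = fullClause-sem n αs βs _ _ refl
    fullClauses-sem (clause n αs βs (just (inj₁ (inj₁ x) , ts))) =
      fullClause-sem n αs βs (just (inj₁ (inj₁ x) , ts)) (just (inj₁ x , ts)) refl
    fullClauses-sem (clause n αs βs (just (inj₁ (inj₂ _) , _)))  = mk⇔ (λ _ → All.[]) (λ _ _ _ _ → refl)
    fullClauses-sem (clause n αs βs (just (inj₂ y , ts)))        =
      fullClause-sem n αs βs (just (inj₂ y , ts)) (just (inj₂ (inj₁ y) , ts)) refl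

    module AtInstance {n : ℕ} (b : Vec A n) (z : Vec A a) where
      env env′ : Vec A _
      env  = ā ++ b
      env′ = ā ++ (b ++ z)

      W-eval : ∀ {k} (ts : Vec (Term σ (r + n)) k) → map (evalT 𝒜 env′) (W ts) ≡ map (evalT 𝒜 env) ts
      W-eval = map-evalT-ren 𝒜 (lookup-weaken ā b z)

      zvars-eval : map (evalT 𝒜 env′) (zvars n) ≡ z
      zvars-eval = map-evalT-vars 𝒜 _ env′ z λ j → trans (VP.lookup-++ʳ ā (b ++ z) _) (VP.lookup-++ʳ b z j)

      extended-eval : ∀ {k} (ts : Vec (Term σ (r + n)) k) → map (evalT 𝒜 env′) (W ts ++ zvars n) ≡ map (evalT 𝒜 env) ts ++ z
      extended-eval ts = trans (VP.map-++ _ (W ts) (zvars n)) (cong₂ _++_ (W-eval ts) zvars-eval)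

      allBut⇔≢ : ∀ {k} (ts : Vec (Term σ (r + n)) k) (e : k ≡ a) →
                 (subst (Vec A) e (map (evalT 𝒜 env) ts) ≢ z) ⇔
                 Any (LitSem 𝒜 env′) (≢-literals (subst (Vec _) e (W ts)) (zvars n))
      allBut⇔≢ ts refl =
        ⇔.sym (⇔.trans (Any-≢-literals _≟_ 𝒜 env′ (W ts) (zvars n)) (≡⇒⇔ (cong₂ _≢_ (W-eval ts) zvars-eval)))

      allButAtom-sem : ∀ α → HAtomSem 𝒜 (IallBut z) env α ⇔
                   (All (HAtomSem 𝒜 Itgt env′) (proj₁ (allButAtom n α)) ×
                    All (Any (LitSem 𝒜 env′)) (proj₂ (allButAtom n α)))
      allButAtom-sem (hrel (inj₁ (inj₁ x)) ts) = ⇔-All-left (≡⇒⇔ (cong (λ v → ρ x v ≡ true) (sym (W-eval ts))))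
      allButAtom-sem (hrel (inj₁ (inj₂ _)) ts) = ⇔-All-right (⇔.trans (allBut-true _≟_) (allBut⇔≢ ts refl))
      allButAtom-sem (hrel (inj₂ y) ts)        =
        ⇔-All-left (≡⇒⇔ (cong (λ v → S (inj₂ y) v ≡ true) (sym (extended-eval ts))))
      allButAtom-sem (huniv t (inj₁ (inj₁ x)) j l e ws) =
        ⇔-All-left (Π-cong⇔ λ c → ≡⇒⇔ (cong (λ w → ρ x (subst (Vec A) (sym e) (c ++ w)) ≡ true) (sym (W-eval ws))))
      allButAtom-sem (huniv t (inj₁ (inj₂ _)) j l e ws) = ⇔-All-right (begin
        ((c : Vec A j) → allBut _≟_ z (subst (Vec A) (sym e) (c ++ map (evalT 𝒜 env) ws)) ≡ true)
          ≈⟨ Π-cong⇔ (λ c → allBut-true _≟_) ⟩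
        ((c : Vec A j) → subst (Vec A) (sym e) (c ++ map (evalT 𝒜 env) ws) ≢ z)
          ≈⟨ ∀-++≢⇔≢drop e _ z ⟩
        (map (evalT 𝒜 env) ws ≢ V.drop j (subst (Vec A) e z))
          ≈⟨ ≡⇒⇔ (cong₂ _≢_ (sym (W-eval ws)) (sym drop-eval)) ⟩
        (map (evalT 𝒜 env′) (W ws) ≢ map (evalT 𝒜 env′) (V.drop j (subst (Vec _) e (zvars n))))
          ≈⟨ ⇔.sym (Any-≢-literals _≟_ 𝒜 env′ (W ws) _) ⟩
        Any (LitSem 𝒜 env′) (≢-literals (W ws) (V.drop j (subst (Vec _) e (zvars n)))) ∎)
        where
        open ⇔-Reasoning
        drop-eval : map (evalT 𝒜 env′) (V.drop j (subst (Vec _) e (zvars n))) ≡ V.drop j (subst (Vec A) e z)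
        drop-eval = trans (sym (VP.drop-map _ j _)) (cong (V.drop j) (trans (map-subst _ e (zvars n)) (cong (subst (Vec A) e) zvars-eval)))
      allButAtom-sem (huniv t (inj₂ y) j l e ws) = ⇔-All-left (Π-cong⇔ λ c → ≡⇒⇔ (cong (λ v → S (inj₂ y) v ≡ true) (sym
        (trans (cong (λ w → subst (Vec A) (sym e′) (c ++ w)) (extended-eval ws)) (subst-++-assoc e e′ c _ z)))))
        where e′ = trans (cong (_+ a) e) (+-assoc j l a)

      allButHead-sem : ∀ h → HHeadSem 𝒜 (IallBut z) env h ⇔
                   (All (LitSem 𝒜 env′) (proj₂ (allButHead n h)) → HHeadSem 𝒜 Itgt env′ (proj₁ (allButHead n h)))
      allButHead-sem nothing                     = mk⇔ (λ ()) (λ f → f All.[])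
      allButHead-sem (just (inj₁ (inj₁ x) , ts)) =
        ⇔.trans (≡⇒⇔ (cong (λ v → ρ x v ≡ true) (sym (W-eval ts)))) (mk⇔ (λ p _ → p) (λ f → f All.[]))
      allButHead-sem (just (inj₁ (inj₂ _) , ts)) =
        ⇔.trans (allBut-true _≟_) (→-cong⇔ (⇔.trans (≡⇒⇔ (cong₂ _≡_ (sym (W-eval ts)) (sym zvars-eval)))
                                                    (⇔.sym (All-≡-literals _≟_ 𝒜 env′ (W ts) (zvars n)))) ⇔.refl)
      allButHead-sem (just (inj₂ y , ts))        =
        ⇔.trans (≡⇒⇔ (cong (λ v → S (inj₂ y) v ≡ true) (sym (extended-eval ts)))) (mk⇔ (λ p _ → p) (λ f → f All.[]))

      allButCond-sem : ∀ β → CondSem 𝒜 env β ⇔ CondSem 𝒜 env′ (allButCond n β)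
      allButCond-sem (lit L)  = ≡⇒⇔ (sym (LitSem-ren 𝒜 (lookup-weaken ā b z) L))
      allButCond-sem (fo t φ) = ⇔.sym (FormSem-ren 𝒜 (lookup-weaken ā b z) φ)

      -- A disjunction in the body of a clause splits the clause into one clause per choice of disjuncts.
      allButClauseAt-sem : ∀ αs βs h → HClauseSemAt 𝒜 (IallBut z) ā (clause n αs βs h) b ⇔
                       (∀ {ch} → ch ∈ choices (allButDisjunctions n αs) →
                                 HClauseSemAt 𝒜 Itgt ā (allButClause n αs βs h ch) (b ++ z))
      allButClauseAt-sem αs βs h = mk⇔ split-disjunction join-disjunction
        where
        atoms⇔ : All (HAtomSem 𝒜 (IallBut z) env) αs ⇔
                 (All (HAtomSem 𝒜 Itgt env′) (L.concatMap (proj₁ ∘ allButAtom n) αs) ×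
                  All (Any (LitSem 𝒜 env′)) (allButDisjunctions n αs))
        atoms⇔ = ⇔.trans (All-cong⇔ allButAtom-sem)
                 (⇔.trans All-×⇔ (×-cong⇔ (⇔.sym (All-concatMap⇔ _)) (⇔.sym (All-concatMap⇔ _))))
        choices⇔ = All-Any⇔Any-All-choices (allButDisjunctions n αs)
        conds⇔ : All (CondSem 𝒜 env) βs ⇔ All (CondSem 𝒜 env′) (L.map (allButCond n) βs)
        conds⇔ = ⇔.trans (All-cong⇔ allButCond-sem) (⇔.sym All-map⇔)
        head⇔ = allButHead-sem h

        split-disjunction : HClauseSemAt 𝒜 (IallBut z) ā (clause n αs βs h) b →
                            ∀ {ch} → ch ∈ choices (allButDisjunctions n αs) →
                            HClauseSemAt 𝒜 Itgt ā (allButClause n αs βs h ch) (b ++ z)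
        split-disjunction cl ch∈ αs′-hold conds with AllP.++⁻ (L.map (allButCond n) βs) conds
        ... | βs′-hold , lits with AllP.++⁻ (proj₂ (allButHead n h)) (AllP.map⁻ lits)
        ... | E-hold , ch-hold =
          to head⇔ (cl (from atoms⇔ (αs′-hold , from choices⇔ (lose ch∈ ch-hold))) (from conds⇔ βs′-hold)) E-hold

        join-disjunction : (∀ {ch} → ch ∈ choices (allButDisjunctions n αs) →
                                     HClauseSemAt 𝒜 Itgt ā (allButClause n αs βs h ch) (b ++ z)) →
                           HClauseSemAt 𝒜 (IallBut z) ā (clause n αs βs h) b
        join-disjunction f αs-hold βs-hold with to atoms⇔ αs-hold
        ... | αs′-hold , ds-hold with find (to choices⇔ ds-hold)
        ... | ch , ch∈ , ch-hold =
          from head⇔ λ E-hold → f ch∈ αs′-hold (AllP.++⁺ (to conds⇔ βs-hold) (AllP.map⁺ (AllP.++⁺ E-hold ch-hold)))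

    allButClauses-sem : ∀ C → (∀ z → HClauseSem 𝒜 (IallBut z) ā C) ⇔ All (HClauseSem 𝒜 Itgt ā) (allButClauses C)
    allButClauses-sem (clause n αs βs h) = mk⇔
      (λ H → AllP.map⁺ (All.tabulate λ ch∈ b′ → split b′ λ b z → to (allButClauseAt-sem b z αs βs h) (H z b) ch∈))
      (λ H z b → from (allButClauseAt-sem b z αs βs h) λ ch∈ → All.lookup (AllP.map⁻ H) ch∈ (b ++ z))
      where
      open AtInstance
      split : ∀ {P : Vec A (n + a) → Set} b′ → (∀ b z → P (b ++ z)) → P b′
      split {P} b′ f = let b , z , b′≡b++z = V.splitAt n b′ in subst P (sym b′≡b++z) (f b z)

  module _ {Γ : Signature} {a : ℕ} {A : Set} (fin : Finite A) (_≟_ : DecidableEquality A) (𝒜 : Structure σ A)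
           (E : ExForm (Γ ⊕ single a)) (ρ : Interp Γ A) (ā : Vec A r) where
    open ∀-Elimination {Γ} {a} (Ex E)
    open ∀-EliminationSem {Γ} {a} (Ex E) _≟_ 𝒜 ρ ā

    SpecialInstances : Interp (Ex E ⊕ Ex E ⁺ a) A → Set
    SpecialInstances S = All (λ C → HClauseSem 𝒜 (Ifull S) ā C × (∀ z → HClauseSem 𝒜 (IallBut S z) ā C)) (clauses E)

    eliminate-∀-clauses : ExSem 𝒜 (eliminate-∀ E) ρ ā ⇔ Σ _ SpecialInstances
    eliminate-∀-clauses = Σ-cong⇔ λ S → ⇔.trans (All-concatMap⇔ _) (All-cong⇔ λ C →
      ⇔.trans (All-++⇔ (fullClauses C)) (×-cong⇔ (⇔.sym (fullClauses-sem S C)) (⇔.sym (allButClauses-sem S C))))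

    all-instances⇒special : ((R : Rel A a) → ExSem 𝒜 E ⟨ ρ , const R ⟩ ā) → Σ _ SpecialInstances
    all-instances⇒special F = ⟨ proj₁ (F full) , S⁺ ⟩ , All.zip (proj₂ (F full) , All.tabulate λ C∈ z →
        HClauseSem-cong 𝒜 (same z) _ (All.lookup (proj₂ (F (allBut _≟_ z))) C∈))
      where
      S⁺ : Interp (Ex E ⁺ a) A
      S⁺ y w = proj₁ (F (allBut _≟_ (V.drop (ar (Ex E) y) w))) y (V.take (ar (Ex E) y) w)
      same : ∀ z → ⟨ ⟨ ρ , const (allBut _≟_ z) ⟩ , proj₁ (F (allBut _≟_ z)) ⟩ ≐
                   IallBut ⟨ proj₁ (F full) , S⁺ ⟩ z
      same z (inj₁ (inj₁ x)) v = refl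
      same z (inj₁ (inj₂ t)) v = refl
      same z (inj₂ y)        v = sym (cong₂ (λ z′ v′ → proj₁ (F (allBut _≟_ z′)) y v′) (drop-++ v z) (take-++ v z))

    -- R is the intersection of everything and of the sets of all tuples but z̄, for z̄ ∉ R.
    module Intersection (S : Interp (Ex E ⊕ Ex E ⁺ a) A) (R : Rel A a) where

      S-R? : ∀ y v → Dec (S (inj₁ y) v ≡ true × ∀ z → R z ≡ true ⊎ S (inj₂ y) (v ++ z) ≡ true)
      S-R? y v = (S (inj₁ y) v ≟ᵇ true) ×-dec
                 ∀? (finite-Vec fin a) λ z → (R z ≟ᵇ true) ⊎-dec (S (inj₂ y) (v ++ z) ≟ᵇ true)

      I-R : Interp Src A
      I-R = ⟨ ⟨ ρ , const R ⟩ , (λ y → χ (S-R? y)) ⟩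

      family : Maybe (Vec A a) → Interp Src A
      family nothing  = Ifull S
      family (just z) = if R z then Ifull S else IallBut S z

      family-holds : ∀ {C} → HClauseSem 𝒜 (Ifull S) ā C × (∀ z → HClauseSem 𝒜 (IallBut S z) ā C) →
                     ∀ k → HClauseSem 𝒜 (family k) ā C
      family-holds (full-holds , allBut-holds) nothing = full-holds
      family-holds (full-holds , allBut-holds) (just z) with R z
      ... | true  = full-holds
      ... | false = allBut-holds z

      meet-Γ : ∀ p v → ρ p v ≡ true ⇔ (∀ k → family k (inj₁ (inj₁ p)) v ≡ true)
      meet-Γ p v = mk⇔ (λ ρpv k → trans (at k) ρpv) (λ h → h nothing)
        where
        at : ∀ k → family k (inj₁ (inj₁ p)) v ≡ ρ p v
        at nothing = refl
        at (just z) with R z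
        ... | true  = refl
        ... | false = refl

      meet-R : ∀ v → R v ≡ true ⇔ (∀ k → family k (inj₁ (inj₂ tt)) v ≡ true)
      meet-R v = mk⇔ (λ Rv → λ { nothing → refl ; (just z) → at z Rv }) (λ h → back (h (just v)))
        where
        at : ∀ z → R v ≡ true → family (just z) (inj₁ (inj₂ tt)) v ≡ true
        at z Rv with R z in Rz
        ... | true  = refl
        ... | false = from (allBut-true _≟_ {z} {v}) λ { refl → contradiction (trans (sym Rv) Rz) λ () }
        back : family (just v) (inj₁ (inj₂ tt)) v ≡ true → R v ≡ true
        back with R v
        ... | true  = λ _ → refl
        ... | false = λ h → ⊥-elim (to (allBut-true _≟_ {v} {v}) h refl)

      meet-Ex : ∀ y v → χ (S-R? y) v ≡ true ⇔ (∀ k → family k (inj₂ y) v ≡ true)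
      meet-Ex y v = ⇔.trans (χ-true (S-R? y))
        (mk⇔ (λ (S¹ , q) → λ { nothing → S¹ ; (just z) → at z S¹ (q z) }) (λ h → h nothing , λ z → back z (h (just z))))
        where
        at : ∀ z → S (inj₁ y) v ≡ true → R z ≡ true ⊎ S (inj₂ y) (v ++ z) ≡ true → family (just z) (inj₂ y) v ≡ true
        at z S¹ q with R z
        ... | true  = S¹
        ... | false = [ (λ ()) , (λ S⁺ → S⁺) ]′ q
        back : ∀ z → family (just z) (inj₂ y) v ≡ true → R z ≡ true ⊎ S (inj₂ y) (v ++ z) ≡ true
        back z with R z
        ... | true  = λ _ → inj₁ refl
        ... | false = inj₂

      meet : ∀ x v → I-R x v ≡ true ⇔ (∀ k → family k x v ≡ true)
      meet (inj₁ (inj₁ p))  = meet-Γ p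
      meet (inj₁ (inj₂ tt)) = meet-R
      meet (inj₂ y)         = meet-Ex y

    special⇒all-instances : Σ _ SpecialInstances → (R : Rel A a) → ExSem 𝒜 E ⟨ ρ , const R ⟩ ā
    special⇒all-instances (S , H) R =
      (λ y → χ (S-R? y)) , All.map (λ {C} h → HClauseSem-⋂ 𝒜 nothing family I-R meet C (family-holds h)) H
      where open Intersection S R

    eliminate-∀-sem : ((R : Rel A a) → ExSem 𝒜 E ⟨ ρ , const R ⟩ ā) ⇔ ExSem 𝒜 (eliminate-∀ E) ρ ā
    eliminate-∀-sem = ⇔.trans (mk⇔ all-instances⇒special special⇒all-instances) (⇔.sym eliminate-∀-clauses)

  step : ∀ {Γ a} → Quant → ExForm (Γ ⊕ single a) → ExForm Γ
  step ∀q = eliminate-∀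
  step ∃q = absorb-∃

  step-sem : ∀ {Γ a A} (fin : Finite A) (_≟_ : DecidableEquality A) (𝒜 : Structure σ A) Q (E : ExForm (Γ ⊕ single a)) ρ ā →
             QSem Q (λ (R : Rel A a) → ExSem 𝒜 E ⟨ ρ , const R ⟩ ā) ⇔ ExSem 𝒜 (step Q E) ρ ā
  step-sem fin _≟_ 𝒜 ∀q E ρ ā = eliminate-∀-sem fin _≟_ 𝒜 E ρ ā
  step-sem fin _≟_ 𝒜 ∃q E ρ ā = absorb-∃-sem 𝒜 E ρ ā

  shift : ∀ {Γ m} (ar : Fin (suc m) → ℕ) → Γ ⊕ sig (Fin (suc m)) ar ⇒ˢ Γ ⊕ single (ar zero) ⊕ sig (Fin m) (ar ∘ suc)
  shift ar = record
    { ren    = λ { (inj₁ x) → inj₁ (inj₁ x) ; (inj₂ zero) → inj₁ (inj₂ tt) ; (inj₂ (suc i)) → inj₂ i }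
    ; ar-ren = λ { (inj₁ x) → refl ; (inj₂ zero) → refl ; (inj₂ (suc i)) → refl }
    }

  toExForm : ∀ {Γ} m (q : Fin m → Quant) (ar : Fin m → ℕ) → List (HClause (Γ ⊕ sig (Fin m) ar)) → ExForm Γ
  toExForm zero    q ar Cs = record { Ex = sig (Fin 0) ar ; encoding = encoding-Fin 0 ; clauses = Cs }
  toExForm (suc m) q ar Cs = step (q zero) (toExForm m (q ∘ suc) (ar ∘ suc) (L.map (rename (shift ar)) Cs))

  toExForm-sem : ∀ {Γ A} (fin : Finite A) (_≟_ : DecidableEquality A) (𝒜 : Structure σ A) m q ar Cs (ρ : Interp Γ A) ā →
                 PrefixSem A m q ar (λ Rs → All (HClauseSem 𝒜 ⟨ ρ , Rs ⟩ ā) Cs) ⇔ ExSem 𝒜 (toExForm m q ar Cs) ρ ā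
  toExForm-sem fin _≟_ 𝒜 zero q ar Cs ρ ā =
    mk⇔ (λ H → (λ ()) , HClausesSem-cong 𝒜 no-symbols H) (λ (_ , H) → HClausesSem-cong 𝒜 no-symbols H)
    where
    no-symbols : ∀ {S S′ : Interp (sig (Fin 0) ar) _} → ⟨ ρ , S ⟩ ≐ ⟨ ρ , S′ ⟩
    no-symbols (inj₁ x) v = refl
  toExForm-sem fin _≟_ 𝒜 (suc m) q ar Cs ρ ā =
    ⇔.trans (QSem-cong (q zero) λ R₀ →
               ⇔.trans (PrefixSem-cong m (q ∘ suc) (ar ∘ suc) λ Rs → shifted R₀ Rs _ (λ _ → refl) (λ _ _ → refl))
                       (toExForm-sem fin _≟_ 𝒜 m (q ∘ suc) (ar ∘ suc) _ _ ā))
            (step-sem fin _≟_ 𝒜 (q zero) _ ρ ā)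
    where
    shifted : ∀ R₀ Rs Rs′ → (∀ v → Rs′ zero v ≡ R₀ v) → (∀ i v → Rs′ (suc i) v ≡ Rs i v) →
              All (HClauseSem 𝒜 ⟨ ρ , Rs′ ⟩ ā) Cs ⇔
              All (HClauseSem 𝒜 ⟨ ⟨ ρ , const R₀ ⟩ , Rs ⟩ ā) (L.map (rename (shift ar)) Cs)
    shifted R₀ Rs Rs′ Rs′₀ Rs′ₛ = ⇔.sym (⇔.trans (HClausesSem-rename (shift ar) 𝒜 _ ā Cs)
                                                 (mk⇔ (HClausesSem-cong 𝒜 pulled) (HClausesSem-cong 𝒜 (≐-sym pulled))))
      where
      pulled : pull (shift ar) ⟨ ⟨ ρ , const R₀ ⟩ , Rs ⟩ ≐ ⟨ ρ , Rs′ ⟩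
      pulled (inj₁ x)       v = refl
      pulled (inj₂ zero)    v = sym (Rs′₀ v)
      pulled (inj₂ (suc i)) v = sym (Rs′ₛ i v)

-- From SO-HORN to DATALOG

nonZero-+suc : ∀ m n → NonZero (m + suc n)
nonZero-+suc zero    n = _
nonZero-+suc (suc m) n = _

module ToDatalog (s u : Bool) (σ : Vocab) (r : ℕ) where
  open Horn s u σ r
  open NormalForm s u σ r
  open Renaming {σ}
  open Terms {σ}
  open ExForm

  no-relations : ∀ {A} → Interp ∅ A
  no-relations ()

  module _ (E : ExForm ∅) where

    e : ℕ
    e = size (encoding E)

    ExFin : Signature
    ExFin = sig (Fin e) (ar (Ex E) ∘ decode (encoding E))

    recode : ∅ ⊕ Ex E ⇒ˢ ExFin
    recode = record
      { ren    = [ (λ ()) , encode (encoding E) ]′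
      ; ar-ren = λ { (inj₂ y) → cong (ar (Ex E)) (decode-encode (encoding E) y) }
      }

    finClauses : List (HClause ExFin)
    finClauses = L.map (rename recode) (clauses E)

    recode-sem : ∀ {A} (𝒜 : Structure σ A) ā →
                 ExSem 𝒜 E no-relations ā ⇔ Σ (Interp ExFin A) λ S → All (HClauseSem 𝒜 S ā) finClauses
    recode-sem {A} 𝒜 ā = mk⇔
      (λ (S , H) → S ∘ decode (encoding E) , from renamed (HClausesSem-cong 𝒜 (decoded S) H))
      (λ (S , H) → (λ y → pull recode S (inj₂ y)) , HClausesSem-cong 𝒜 (λ { (inj₂ y) v → refl }) (to renamed H))
      where
      renamed = λ {S} → HClausesSem-rename recode 𝒜 S ā (clauses E)
      transport : ∀ (S : Interp (Ex E) A) {y′ y} (p : y′ ≡ y) v → S y v ≡ S y′ (subst (Vec A) (sym (cong (ar (Ex E)) p)) v)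
      transport S refl v = refl
      decoded : ∀ S → ⟨ no-relations , S ⟩ ≐ pull recode (S ∘ decode (encoding E))
      decoded S (inj₂ y) = transport S (decode-encode (encoding E) y)

  module DatalogOf {e : ℕ} {ear : Fin e → ℕ} (Cs : List (HClause (sig (Fin e) ear))) where

    I : ℕ
    I = suc e

    -- The goal symbol zero has arity r; the symbol of an existential relation of arity k has
    -- arity k + 1 + r: the extra place keeps the arity nonzero and the last r places carry
    -- the values of the free variables.
    iar : Fin I → ℕ
    iar zero    = r
    iar (suc i) = ear i + suc r

    Rule′ : Set
    Rule′ = Rule s u σ I iar

    module Translate (n : ℕ) where
      nv : ℕ
      nv = suc (r + n)

      wk : ∀ {k} → Vec (Term σ (r + n)) k → Vec (Term σ nv) k
      wk = map (renT suc)

      free : Vec (Term σ nv) r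
      free = vars λ i → suc (i Fin.↑ˡ n)

      extend : ∀ {k} → Vec (Term σ (r + n)) k → Vec (Term σ nv) (k + suc r)
      extend ts = wk ts ++ (var zero ∷ free)

      bodyAtom : HAtom (sig (Fin e) ear) (r + n) → Body s u σ I iar nv
      bodyAtom (hrel i ts)          = iatom (suc i) (nonZero-+suc _ r) (extend ts)
      bodyAtom (huniv t i j l eq ws) =
        iuniv t (suc i) (nonZero-+suc _ r) j (l + suc r) (trans (cong (_+ suc r) eq) (+-assoc j l (suc r))) (extend ws)

      bodyCond : Condition (r + n) → Body s u σ I iar nv
      bodyCond (lit L)  = elit (renL suc L)
      bodyCond (fo t φ) = efo t (renF suc φ)

      ruleHead : HHead (sig (Fin e) ear) (r + n) → Σ (Fin I) λ p → Vec (Term σ nv) (iar p)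
      ruleHead nothing         = zero , free
      ruleHead (just (i , ts)) = suc i , extend ts

    ruleOf : HClause (sig (Fin e) ear) → Rule′
    ruleOf (clause n αs βs h) = record
      { nv = nv ; hd = proj₁ (ruleHead h) ; hargs = proj₂ (ruleHead h) ; body = L.map bodyAtom αs L.++ L.map bodyCond βs }
      where open Translate n

    -- Guarantees that every symbol occurs in a head; its body x ≠ x never holds.
    dummy : Fin I → Rule′
    dummy p = record { nv = 1 ; hd = p ; hargs = V.replicate (iar p) (var zero) ; body = elit (neg (eqA (var zero) (var zero))) ∷ [] }

    rules : List Rule′
    rules = L.map ruleOf Cs L.++ L.map dummy (L.allFin I)

    program : Program s u σ
    program = record
      { I = I ; iar = iar ; rules = rules
      ; heads = λ p → AnyP.++⁺ʳ (L.map ruleOf Cs) (AnyP.map⁺ (Any.map (λ { refl → refl }) (∈-allFin p)))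
      }

    datalog : DatalogFormula s u σ r
    datalog = record { prog = program ; P = zero ; arityP = refl }

    module Correctness {A : Set} (fin : Finite A) (_≟_ : DecidableEquality A) (a₀ : A) (𝒜 : Structure σ A) (ā : Vec A r) where
      open Fixpoint fin _≟_ 𝒜 rules

      module Instance {n : ℕ} (x : A) (ā′ : Vec A r) (b : Vec A n) where
        open Translate n

        env : Vec A (r + n)
        env = ā′ ++ b

        env⁺ : Vec A nv
        env⁺ = x ∷ env

        free-eval : map (evalT 𝒜 env⁺) free ≡ ā′
        free-eval = map-evalT-vars 𝒜 _ env⁺ ā′ λ i → VP.lookup-++ˡ ā′ b i

        extend-eval : ∀ {k} (ts : Vec (Term σ (r + n)) k) →
                      map (evalT 𝒜 env⁺) (extend ts) ≡ map (evalT 𝒜 env) ts ++ (x ∷ ā′)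
        extend-eval ts = trans (VP.map-++ _ (wk ts) _) (cong₂ _++_ (map-evalT-ren 𝒜 (λ _ → refl) ts) (cong (x ∷_) free-eval))

        univ-eval : ∀ {k j l} (eq : k ≡ j + l) (ws : Vec (Term σ (r + n)) l) (c : Vec A j) →
                    subst (Vec A) (sym (trans (cong (_+ suc r) eq) (+-assoc j l (suc r)))) (c ++ map (evalT 𝒜 env⁺) (extend ws))
                    ≡ subst (Vec A) (sym eq) (c ++ map (evalT 𝒜 env) ws) ++ (x ∷ ā′)
        univ-eval eq ws c = trans (cong (λ w → subst (Vec A) _ (c ++ w)) (extend-eval ws)) (subst-++-assoc eq _ c _ _)

        module _ {J : IRel} {S : Interp (sig (Fin e) ear) A} where

          atom-in : (∀ {i v} → S i v ≡ true → J (suc i) (v ++ (x ∷ ā′))) →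
                    ∀ α → HAtomSem 𝒜 S env α → BodySem 𝒜 J env⁺ (bodyAtom α)
          atom-in S⇒J (hrel i ts)           h   = subst (J (suc i)) (sym (extend-eval ts)) (S⇒J h)
          atom-in S⇒J (huniv t i j l eq ws) h c = subst (J (suc i)) (sym (univ-eval eq ws c)) (S⇒J (h c))

          atom-out : (∀ {i v} → J (suc i) (v ++ (x ∷ ā′)) → S i v ≡ true) →
                     ∀ α → BodySem 𝒜 J env⁺ (bodyAtom α) → HAtomSem 𝒜 S env α
          atom-out J⇒S (hrel i ts)           h   = J⇒S (subst (J (suc i)) (extend-eval ts) h)
          atom-out J⇒S (huniv t i j l eq ws) h c = J⇒S (subst (J (suc i)) (univ-eval eq ws c) (h c))

          cond⇔ : ∀ β → CondSem 𝒜 env β ⇔ BodySem 𝒜 J env⁺ (bodyCond β)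
          cond⇔ (lit L)  = ≡⇒⇔ (sym (LitSem-ren 𝒜 (λ _ → refl) L))
          cond⇔ (fo t φ) = ⇔.sym (FormSem-ren 𝒜 (λ _ → refl) φ)

          body-in : (∀ {i v} → S i v ≡ true → J (suc i) (v ++ (x ∷ ā′))) → ∀ {αs βs} →
                    All (HAtomSem 𝒜 S env) αs → All (CondSem 𝒜 env) βs →
                    All (BodySem 𝒜 J env⁺) (L.map bodyAtom αs L.++ L.map bodyCond βs)
          body-in S⇒J αs-hold βs-hold =
            AllP.++⁺ (AllP.map⁺ (All.map (λ {α} → atom-in S⇒J α) αs-hold))
                     (AllP.map⁺ (All.map (λ {β} → to (cond⇔ β)) βs-hold))

          body-out : (∀ {i v} → J (suc i) (v ++ (x ∷ ā′)) → S i v ≡ true) → ∀ αs {βs} →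
                     All (BodySem 𝒜 J env⁺) (L.map bodyAtom αs L.++ L.map bodyCond βs) →
                     All (HAtomSem 𝒜 S env) αs × All (CondSem 𝒜 env) βs
          body-out J⇒S αs bs with AllP.++⁻ (L.map bodyAtom αs) bs
          ... | αs-hold , βs-hold =
            All.map (λ {α} → atom-out J⇒S α) (AllP.map⁻ αs-hold) , All.map (λ {β} → from (cond⇔ β)) (AllP.map⁻ βs-hold)

      least-model : ¬ Fix zero ā → Σ (Interp (sig (Fin e) ear) A) λ S → All (HClauseSem 𝒜 S ā) Cs
      least-model ¬fix = S , All.tabulate λ C∈ → holds _ C∈
        where
        S : Interp (sig (Fin e) ear) A
        S i = χ λ v → Fix? (suc i) (v ++ (a₀ ∷ ā))

        S-true : ∀ {i v} → S i v ≡ true ⇔ Fix (suc i) (v ++ (a₀ ∷ ā))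
        S-true {i} = χ-true λ v → Fix? (suc i) (v ++ (a₀ ∷ ā))

        holds : ∀ C → C ∈ Cs → HClauseSem 𝒜 S ā C
        holds (clause n αs βs h) C∈ b αs-hold βs-hold =
          conclude h (Fix-closed _ (∈-++⁺ˡ (∈-map⁺ ruleOf C∈)) env⁺ (body-in (to S-true) αs-hold βs-hold))
          where
          open Instance a₀ ā b
          open Translate n
          conclude : ∀ h → Fix (proj₁ (ruleHead h)) (map (evalT 𝒜 env⁺) (proj₂ (ruleHead h))) → HHeadSem 𝒜 S env h
          conclude nothing         fix = ¬fix (subst (Fix zero) free-eval fix)
          conclude (just (i , ts)) fix = from S-true (subst (Fix (suc i)) (extend-eval ts) fix)

      model⇒¬goal : Σ (Interp (sig (Fin e) ear) A) (λ S → All (HClauseSem 𝒜 S ā) Cs) → ¬ Fix zero ā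
      model⇒¬goal (S , H) fix = Fix-least closed fix refl
        where
        -- The relations of the program that S determines at the parameters ā.
        Jₛ : IRel
        Jₛ zero    w = w ≢ ā
        Jₛ (suc i) w = ∀ v x → w ≡ v ++ (x ∷ ā) → S i v ≡ true

        clause-closed : ∀ C → C ∈ Cs → ∀ env → All (BodySem 𝒜 Jₛ env) (Rule.body (ruleOf C)) →
                        Jₛ (Rule.hd (ruleOf C)) (map (evalT 𝒜 env) (Rule.hargs (ruleOf C)))
        clause-closed (clause n αs βs h) C∈ (x ∷ env₀) bs with V.splitAt r env₀
        ... | ā′ , b , refl = conclude h head-holds
          where
          open Instance x ā′ b
          open Translate n
          head-holds : ā′ ≡ ā → HHeadSem 𝒜 S env h
          head-holds refl = uncurry (All.lookup H C∈ b) (body-out (λ J → J _ x refl) αs bs)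
          conclude : ∀ h → (ā′ ≡ ā → HHeadSem 𝒜 S env h) →
                     Jₛ (proj₁ (ruleHead h)) (map (evalT 𝒜 env⁺) (proj₂ (ruleHead h)))
          conclude nothing         hh eq = hh (trans (sym free-eval) eq)
          conclude (just (i , ts)) hh v x′ eq with VP.++-injective (map (evalT 𝒜 env) ts) v (trans (sym (extend-eval ts)) eq)
          ... | refl , tail-eq = hh (VP.∷-injectiveʳ tail-eq)

        closed : Closed Jₛ
        closed ρ ρ∈ env bs with ∈-++⁻ (L.map ruleOf Cs) ρ∈
        ... | inj₁ ρ∈Cs with ∈-map⁻ ruleOf ρ∈Cs
        ...   | C , C∈ , refl = clause-closed C C∈ env bs
        closed ρ ρ∈ env bs | inj₂ ρ∈dummies with ∈-map⁻ dummy ρ∈dummies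
        ...   | p , _ , refl = ⊥-elim (All.head bs refl)

      datalog-sem : (Σ (Interp (sig (Fin e) ear) A) λ S → All (HClauseSem 𝒜 S ā) Cs) ⇔ (¬ InFix 𝒜 datalog ā)
      datalog-sem = mk⇔ model⇒¬goal least-model

module FromSOHorn (s u : Bool) (σ : Vocab) (r : ℕ) (φ : SOHorn s u σ r) where
  open Horn s u σ r
  open NormalForm s u σ r
  open ToDatalog s u σ r
  module φ = SOHorn φ

  RelVars : Signature
  RelVars = sig (Fin φ.m) φ.ar

  toHAtom : SOAtom s u σ φ.m φ.ar (r + φ.k) → HAtom (∅ ⊕ RelVars) (r + φ.k)
  toHAtom (ratom i ts)         = hrel (inj₂ i) ts
  toHAtom (uatom t i j l e ws) = huniv t (inj₂ i) j l e ws

  toCondition : Beta s u σ φ.m φ.ar (r + φ.k) → Condition (r + φ.k)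
  toCondition (lit L)  = lit L
  toCondition (fo t ψ) = fo t ψ

  toHHead : Maybe (Σ (Fin φ.m) λ i → Vec (Term σ (r + φ.k)) (φ.ar i)) → HHead (∅ ⊕ RelVars) (r + φ.k)
  toHHead nothing         = nothing
  toHHead (just (i , ts)) = just (inj₂ i , ts)

  toHClause : Clause s u σ φ.m φ.ar (r + φ.k) → HClause (∅ ⊕ RelVars)
  toHClause C = clause φ.k (L.map toHAtom (Clause.alphas C)) (L.map toCondition (Clause.betas C)) (toHHead (Clause.head C))

  exForm : ExForm ∅
  exForm = toExForm φ.m φ.q φ.ar (L.map toHClause φ.clauses)

  D : DatalogFormula s u σ r
  D = DatalogOf.datalog (finClauses exForm)

  module _ {A : Set} (𝒜 : Structure σ A) (ā : Vec A r) (Rs : Interp RelVars A) where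

    ClauseSem⇔ : ∀ b C → ClauseSem 𝒜 Rs (ā ++ b) C ⇔ HClauseSemAt 𝒜 ⟨ no-relations , Rs ⟩ ā (toHClause C) b
    ClauseSem⇔ b C = →-cong⇔ (⇔.trans (All-cong⇔ atom⇔) (⇔.sym All-map⇔))
                      (→-cong⇔ (⇔.trans (All-cong⇔ cond⇔) (⇔.sym All-map⇔)) (head⇔ (Clause.head C)))
      where
      atom⇔ : ∀ α → SOAtomSem 𝒜 Rs (ā ++ b) α ⇔ HAtomSem 𝒜 ⟨ no-relations , Rs ⟩ (ā ++ b) (toHAtom α)
      atom⇔ (ratom i ts)         = ⇔.refl
      atom⇔ (uatom t i j l e ws) = ⇔.refl
      cond⇔ : ∀ β → BetaSem 𝒜 Rs (ā ++ b) β ⇔ CondSem 𝒜 (ā ++ b) (toCondition β)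
      cond⇔ (lit L)  = ⇔.refl
      cond⇔ (fo t ψ) = ⇔.refl
      head⇔ : ∀ h → HeadSem {s = s} {u = u} 𝒜 Rs (ā ++ b) h ⇔ HHeadSem 𝒜 ⟨ no-relations , Rs ⟩ (ā ++ b) (toHHead h)
      head⇔ nothing         = ⇔.refl
      head⇔ (just (i , ts)) = ⇔.refl

    matrix⇔ : ((b : Vec A φ.k) → All (ClauseSem 𝒜 Rs (ā ++ b)) φ.clauses) ⇔
              All (HClauseSem 𝒜 ⟨ no-relations , Rs ⟩ ā) (L.map toHClause φ.clauses)
    matrix⇔ = ⇔.trans Π-All⇔All-Π (⇔.trans (All-cong⇔ λ C → Π-cong⇔ λ b → ClauseSem⇔ b C) (⇔.sym All-map⇔))

  matrix-cong : ∀ {A} (𝒜 : Structure σ A) ā {Rs Rs′ : Interp RelVars A} → Rs ≐ Rs′ →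
                ((b : Vec A φ.k) → All (ClauseSem 𝒜 Rs (ā ++ b)) φ.clauses) →
                ((b : Vec A φ.k) → All (ClauseSem 𝒜 Rs′ (ā ++ b)) φ.clauses)
  matrix-cong 𝒜 ā {Rs} {Rs′} Rs≐Rs′ =
    from (matrix⇔ 𝒜 ā Rs′) ∘ HClausesSem-cong 𝒜 (λ { (inj₂ i) → Rs≐Rs′ i }) ∘ to (matrix⇔ 𝒜 ā Rs)

  corresponds : Corresponds φ D
  corresponds N 𝒜 ā = begin
    Sat 𝒜 φ ā
      ≈⟨ PrefixSem-cong φ.m φ.q φ.ar (matrix⇔ 𝒜 ā) ⟩
    PrefixSem _ φ.m φ.q φ.ar (λ Rs → All (HClauseSem 𝒜 ⟨ no-relations , Rs ⟩ ā) (L.map toHClause φ.clauses))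
      ≈⟨ toExForm-sem fin _≟_ 𝒜 φ.m φ.q φ.ar _ no-relations ā ⟩
    ExSem 𝒜 exForm no-relations ā
      ≈⟨ recode-sem exForm 𝒜 ā ⟩
    Σ _ (λ S → All (HClauseSem 𝒜 S ā) (finClauses exForm))
      ≈⟨ DatalogOf.Correctness.datalog-sem (finClauses exForm) fin _≟_ zero 𝒜 ā ⟩
    (¬ InFix 𝒜 D ā) ∎
    where
    open ⇔-Reasoning
    fin = finite-Fin (suc N)
    _≟_ = Fin._≟_

-- From DATALOG to SO-HORN

module FromDatalog {s u : Bool} {σ : Vocab} {r : ℕ} (D : DatalogFormula s u σ r) where
  open Renaming {σ}
  open Terms {σ}
  module D = DatalogFormula D
  module Π = Program D.prog

  Rule′ : Set
  Rule′ = Rule s u σ Π.I Π.iar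

  k : ℕ
  k = max 0 (L.map Rule.nv Π.rules)

  nv≤k : ∀ {ρ} → ρ ∈ Π.rules → Rule.nv ρ ≤ k
  nv≤k = All.lookup (AllP.map⁻ (xs≤max 0 (L.map Rule.nv Π.rules)))

  module Embed {nv : ℕ} (nv≤k : nv ≤ k) where

    embed : Fin nv → Fin (r + k)
    embed x = r Fin.↑ʳ Fin.inject≤ x nv≤k

    atomsOf : Body s u σ Π.I Π.iar nv → List (SOAtom s u σ Π.I Π.iar (r + k))
    atomsOf (iatom p _ ts)         = ratom p (map (renT embed) ts) ∷ []
    atomsOf (elit _)               = []
    atomsOf (efo _ _)              = []
    atomsOf (iuniv t p _ j l e ws) = uatom t p j l e (map (renT embed) ws) ∷ []

    betasOf : Body s u σ Π.I Π.iar nv → List (Beta s u σ Π.I Π.iar (r + k))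
    betasOf (iatom _ _ _)       = []
    betasOf (elit L)            = lit (renL embed L) ∷ []
    betasOf (efo t ψ)           = fo t (renF embed ψ) ∷ []
    betasOf (iuniv _ _ _ _ _ _ _) = []

  ruleClause : (ρ : Rule′) → Rule.nv ρ ≤ k → Clause s u σ Π.I Π.iar (r + k)
  ruleClause ρ nv≤k = record
    { alphas = L.concatMap atomsOf (Rule.body ρ)
    ; betas  = L.concatMap betasOf (Rule.body ρ)
    ; head   = just (Rule.hd ρ , map (renT embed) (Rule.hargs ρ))
    }
    where open Embed nv≤k

  goal : Vec (Term σ (r + k)) (Π.iar D.P)
  goal = subst (Vec _) (sym D.arityP) (vars (Fin._↑ˡ k))

  goalClause : Clause s u σ Π.I Π.iar (r + k)
  goalClause = record { alphas = ratom D.P goal ∷ [] ; betas = [] ; head = nothing }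

  φ : SOHorn s u σ r
  φ = record
    { m = Π.I ; q = λ _ → ∃q ; ar = Π.iar ; k = k
    ; clauses = mapWith∈ Π.rules (λ {ρ} ρ∈ → ruleClause ρ (nv≤k ρ∈)) L.++ goalClause ∷ []
    }

  module Correctness {A : Set} (fin : Finite A) (_≟_ : DecidableEquality A) (a₀ : A) (𝒜 : Structure σ A) (ā : Vec A r) where
    open Fixpoint fin _≟_ 𝒜 Π.rules

    Rels : Set
    Rels = (p : Fin Π.I) → Rel A (Π.iar p)

    TrueIn : Rels → IRel
    TrueIn Rs p a = Rs p a ≡ true

    module Instance {nv : ℕ} (nv≤k : nv ≤ k) (Rs : Rels) (b : Vec A k) (env : Vec A nv) (b≈env : V.truncate nv≤k b ≡ env) where
      open Embed nv≤k

      compatible : Compatible 𝒜 embed env (ā ++ b)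
      compatible x = trans (VP.lookup-++ʳ ā b _) (trans (sym (VP.lookup-truncate nv≤k b x)) (cong (λ w → lookup w x) b≈env))

      args-eval : ∀ {n} (ts : Vec (Term σ nv) n) → map (evalT 𝒜 (ā ++ b)) (map (renT embed) ts) ≡ map (evalT 𝒜 env) ts
      args-eval = map-evalT-ren 𝒜 compatible

      body⇔ : ∀ bd → BodySem 𝒜 (TrueIn Rs) env bd ⇔
              (All (SOAtomSem 𝒜 Rs (ā ++ b)) (atomsOf bd) × All (BetaSem 𝒜 Rs (ā ++ b)) (betasOf bd))
      body⇔ (iatom p _ ts)         = ⇔-All-left (≡⇒⇔ (cong (λ w → Rs p w ≡ true) (sym (args-eval ts))))
      body⇔ (elit L)               = ⇔-All-right (≡⇒⇔ (sym (LitSem-ren 𝒜 compatible L)))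
      body⇔ (efo t ψ)              = ⇔-All-right (⇔.sym (FormSem-ren 𝒜 compatible ψ))
      body⇔ (iuniv t p _ j l e ws) =
        ⇔-All-left (Π-cong⇔ λ c → ≡⇒⇔ (cong (λ w → Rs p (subst (Vec A) (sym e) (c ++ w)) ≡ true) (sym (args-eval ws))))

      bodies⇔ : ∀ bds → All (BodySem 𝒜 (TrueIn Rs) env) bds ⇔
                (All (SOAtomSem 𝒜 Rs (ā ++ b)) (L.concatMap atomsOf bds) × All (BetaSem 𝒜 Rs (ā ++ b)) (L.concatMap betasOf bds))
      bodies⇔ bds =
        ⇔.trans (All-cong⇔ body⇔) (⇔.trans All-×⇔ (×-cong⇔ (⇔.sym (All-concatMap⇔ _)) (⇔.sym (All-concatMap⇔ _))))

    goal-eval : ∀ b → map (evalT 𝒜 (ā ++ b)) goal ≡ subst (Vec A) (sym D.arityP) ā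
    goal-eval b = trans (map-subst _ (sym D.arityP) _) (cong (subst (Vec A) _) (map-evalT-vars 𝒜 _ (ā ++ b) ā (VP.lookup-++ˡ ā b)))

    Matrix : Rels → Set
    Matrix Rs = (b : Vec A k) → All (ClauseSem 𝒜 Rs (ā ++ b)) (SOHorn.clauses φ)

    least-model : ¬ InFix 𝒜 D ā → Σ Rels Matrix
    least-model ¬fix = Rs , λ b → AllP.++⁺ (from (All-mapWith∈⇔ Π.rules) (rule-holds b)) (goal-holds b All.∷ All.[])
      where
      Rs : Rels
      Rs p = χ (Fix? p)

      Rs-true : ∀ {p a} → Rs p a ≡ true ⇔ Fix p a
      Rs-true {p} = χ-true (Fix? p)

      rule-holds : ∀ b {ρ} (ρ∈ : ρ ∈ Π.rules) → ClauseSem 𝒜 Rs (ā ++ b) (ruleClause ρ (nv≤k ρ∈))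
      rule-holds b {ρ} ρ∈ αs-hold βs-hold =
        from Rs-true (subst (Fix (Rule.hd ρ)) (sym (args-eval (Rule.hargs ρ)))
          (Fix-closed ρ ρ∈ env (BodiesSem-mono (to Rs-true) env (from (bodies⇔ (Rule.body ρ)) (αs-hold , βs-hold)))))
        where
        env = V.truncate (nv≤k ρ∈) b
        open Instance (nv≤k ρ∈) Rs b env refl

      goal-holds : ∀ b → ClauseSem 𝒜 Rs (ā ++ b) goalClause
      goal-holds b (goal-true All.∷ All.[]) All.[] = ¬fix (to Rs-true (subst (λ w → Rs D.P w ≡ true) (goal-eval b) goal-true))

    model⇒¬goal : Σ Rels Matrix → ¬ InFix 𝒜 D ā
    model⇒¬goal (Rs , M) fix = All.head (AllP.++⁻ʳ _ (M b₀)) (goal-true All.∷ All.[]) All.[]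
      where
      b₀ = V.replicate k a₀

      closed : Closed (TrueIn Rs)
      closed ρ ρ∈ env bs =
        subst (λ w → Rs (Rule.hd ρ) w ≡ true) (args-eval (Rule.hargs ρ)) (uncurry rule-clause (to (bodies⇔ (Rule.body ρ)) bs))
        where
        b = V.padRight (nv≤k ρ∈) a₀ env
        rule-clause = to (All-mapWith∈⇔ Π.rules) (AllP.++⁻ˡ _ (M b)) ρ∈
        open Instance (nv≤k ρ∈) Rs b env (VP.truncate-padRight (nv≤k ρ∈) a₀ env)

      goal-true : Rs D.P (map (evalT 𝒜 (ā ++ b₀)) goal) ≡ true
      goal-true = subst (λ w → Rs D.P w ≡ true) (sym (goal-eval b₀)) (Fix-least closed fix)

    datalog-sem : Σ Rels Matrix ⇔ (¬ InFix 𝒜 D ā)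
    datalog-sem = mk⇔ model⇒¬goal least-model

  corresponds : Corresponds φ D
  corresponds N 𝒜 ā =
    ⇔.trans (PrefixSem-∃ Π.I Π.iar (FromSOHorn.matrix-cong _ _ _ _ φ 𝒜 ā))
            (Correctness.datalog-sem (finite-Fin (suc N)) Fin._≟_ zero 𝒜 ā)

proposition4 : (s u : Bool) →
    ((σ : Vocab) (r : ℕ) (φ : SOHorn s u σ r) →
       Σ (DatalogFormula s u σ r) (λ D → Corresponds φ D))
    × ((σ : Vocab) (r : ℕ) (D : DatalogFormula s u σ r) →
       Σ (SOHorn s u σ r) (λ φ → Corresponds φ D))
proposition4 s u =
  (λ σ r φ → FromSOHorn.D s u σ r φ , FromSOHorn.corresponds s u σ r φ) ,
  (λ σ r D → FromDatalog.φ D , FromDatalog.corresponds D)
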